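{- Let $\alpha$ be a type-$B$ composition of $n$ and let $\iota:\mathfrak{H}_\alpha\to\mathfrak{H}_\alpha$, $\iota(\pi)=\pi\,\omega_{\mathsf{o};\alpha}$. The map $\iota$ is order-reversing on $(\mathfrak{H}_\alpha,\leq_{\mathsf{weak}})$.
   Context: $\mathfrak{H}_n$ is the group of permutations $\pi$ of $\pm[n]=\{ -n,\dots,-1,1,\dots,n\}$ with $\pi(-a)=-\pi(a)$, product given by composition, the Coxeter group of type $B_n$ with simple generators $s_0$ (exchanging $1,-1$) and $s_i$ (exchanging $i,i+1$ and $-i,-i-1$); $\ell_S$ is Coxeter length. $\mathsf{Inv}(\pi)$ consists of $[\![i]\!]$ with $\pi(i)<0$, $(\!(i\;j)\!)$ ($0<i<j$) with $\pi(i)>\pi(j)$, and $(\!(-j\;i)\!)$ ($0<i<j$) with $\pi(-j)>\pi(i)$. Weak order: $u\le_{\mathsf{weak}}v$ iff $\mathsf{Inv}(u)\subseteq\mathsf{Inv}(v)$. A type-$B$ composition of $n$: positive integers $(\alpha_1,\dots,\alpha_r)$ summing to $n$, possibly preceded by a component $0$ (split if present, join otherwise); $p_0=0$, $p_i=\alpha_1+\dots+\alpha_i$. $J_\alpha=\{s_{p_1},\dots,s_{p_{r-1}}\}$ plus $s_0$ if split; $\mathfrak{H}_\alpha=\{w:\ell_S(ws)>\ell_S(w)\ \forall s\in S\setminus J_\alpha\}$; equivalently the $\pi$ increasing on each block of $\mathsf{Part}(\alpha)$, whose blocks are $\{p_{i-1}+1,\dots,p_i\}$ and $\{ -p_i,\dots,-p_{i-1}-1\}$,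 $1\le i\le r$, with the two $i=1$ blocks merged if $\alpha$ is join. $\omega_{\mathsf{o};\alpha}$ is the longest element of $\mathfrak{H}_\alpha$. (Concretely $\iota(\pi)$ is obtained by negating all values of $\pi$ and reversing them within each block, and $\iota(\pi)\in\mathfrak{H}_\alpha$.) -}

module Defs where

open import Data.Nat as ℕ using (ℕ; zero; suc)
open import Data.Integer as ℤ using (ℤ; +_; -[1+_]; ∣_∣)
open import Data.Fin using (Fin; toℕ)
open import Data.Vec using (Vec; []; _∷_; map; tabulate; lookup)
open import Data.List using (List; []; _∷_; length)
open import Data.Nat.ListAction using (sum)
open import Data.List.Membership.Propositional using (_∈_)
open import Data.List.Relation.Unary.All using (All)
open import Data.Bool using (Bool; true; false; if_then_else_)
open import Data.Product using (Σ; _×_)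
open import Data.Sum using (_⊎_)
open import Relation.Binary.PropositionalEquality using (_≡_)
open import Relation.Nullary using (¬_)
open import Relation.Nullary.Decidable using (⌊_⌋)

-- Signed permutations of ±[n], represented by the vector of values
-- (π(1), …, π(n)); the values on negatives are forced by π(-a) = -π(a).

SPerm : ℕ → Set
SPerm n = Vec ℤ n

-- π is a permutation of ±[n] commuting with negation: every value is
-- in ±[n], and the absolute values are pairwise distinct.
IsSignedPerm : {n : ℕ} → SPerm n → Set
IsSignedPerm {n} π =
  (∀ i → (1 ℕ.≤ ∣ lookup π i ∣) × (∣ lookup π i ∣ ℕ.≤ n)) ×
  (∀ i j → ∣ lookup π i ∣ ≡ ∣ lookup π j ∣ → i ≡ j)

-- value at position k+1 (0 outside the range; never used there)
at : {n : ℕ} → SPerm n → ℕ → ℤ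
at []       _       = + 0
at (x ∷ xs) zero    = x
at (x ∷ xs) (suc k) = at xs k

-- π applied to an element of ±[n] (extended by 0 ↦ 0)
apply : {n : ℕ} → SPerm n → ℤ → ℤ
apply π (+ zero)   = + 0
apply π (+ suc k)  = at π k
apply π -[1+ k ]   = ℤ.- at π k

_·_ : {n : ℕ} → SPerm n → SPerm n → SPerm n
π · σ = map (apply π) σ

idPerm : (n : ℕ) → SPerm n
idPerm n = tabulate (λ j → + suc (toℕ j))

gen : {n : ℕ} → Fin n → SPerm n
gen {n} s = tabulate val
  where
  val : Fin n → ℤ
  val j with toℕ s
  ... | zero  = if ⌊ toℕ j ℕ.≟ 0 ⌋ then ℤ.- (+ 1) else + suc (toℕ j)
  ... | suc i = if ⌊ toℕ j ℕ.≟ i ⌋ then + suc (suc i)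
                else if ⌊ toℕ j ℕ.≟ suc i ⌋ then + suc i
                else + suc (toℕ j)

eval : {n : ℕ} → List (Fin n) → SPerm n
eval {n} []      = idPerm n
eval     (s ∷ w) = gen s · eval w

HasLength : {n : ℕ} → SPerm n → ℕ → Set
HasLength {n} w k =
  Σ (List (Fin n)) (λ word → (eval word ≡ w) × (length word ≡ k)) ×
  (∀ (word : List (Fin n)) → eval word ≡ w → k ℕ.≤ length word)

LengthLess : {n : ℕ} → SPerm n → SPerm n → Set
LengthLess u v = ∀ k k' → HasLength u k → HasLength v k' → k ℕ.< k'

-- ⟦ i ⟧ , ((i j)) and ((-j i)) ; the latter written  negPair j i
data Pair : Set where
  bar     : ℕ → Pair
  posPair : ℕ → ℕ → Pair
  negPair : ℕ → ℕ → Pair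

_∈Inv_ : {n : ℕ} → Pair → SPerm n → Set
_∈Inv_ {n} (bar i) π = (1 ℕ.≤ i) × (i ℕ.≤ n) × (apply π (+ i) ℤ.< + 0)
_∈Inv_ {n} (posPair i j) π =
  (1 ℕ.≤ i) × (i ℕ.< j) × (j ℕ.≤ n) × (apply π (+ j) ℤ.< apply π (+ i))
_∈Inv_ {n} (negPair j i) π =
  (1 ℕ.≤ i) × (i ℕ.< j) × (j ℕ.≤ n) × (apply π (+ i) ℤ.< apply π (ℤ.- (+ j)))

_≤weak_ : {n : ℕ} → SPerm n → SPerm n → Set
u ≤weak v = ∀ x → x ∈Inv u → x ∈Inv v

-- Type-B compositions: a flag (true = split, i.e. a leading 0 component)
-- and the positive parts (α₁, …, α_r).

IsTypeBComposition : ℕ → Bool → List ℕ → Set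
IsTypeBComposition n split αs = All (λ a → 1 ℕ.≤ a) αs × (sum αs ≡ n)

-- p₁, …, p_{r-1} (starting from accumulator p₀ = acc)
innerSums : ℕ → List ℕ → List ℕ
innerSums acc []            = []
innerSums acc (a ∷ [])      = []
innerSums acc (a ∷ b ∷ rest) = (acc ℕ.+ a) ∷ innerSums (acc ℕ.+ a) (b ∷ rest)

InJ : Bool → List ℕ → ℕ → Set
InJ split αs k = ((k ≡ 0) × (split ≡ true)) ⊎ (k ∈ innerSums 0 αs)

InH : {n : ℕ} → Bool → List ℕ → SPerm n → Set
InH {n} split αs w =
  IsSignedPerm w × (∀ (s : Fin n) → ¬ InJ split αs (toℕ s) → LengthLess w (w · gen s))

IsLongestInH : {n : ℕ} → Bool → List ℕ → SPerm n → Set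
IsLongestInH {n} split αs ω =
  InH split αs ω ×
  (∀ (w : SPerm n) → InH split αs w →
     ∀ k k' → HasLength w k → HasLength ω k' → k ℕ.≤ k')

{-# OPTIONS --safe #-}
module Submission where

-- Coxeter length equals the number of inversions, since right multiplication by a generator changes
-- that number by one; so 𝔖^B_α consists of the signed permutations increasing on the blocks of α.
-- Such a permutation has only cross inversions (a negative value outside the join block, a descent
-- between different blocks, a pair ((-j i)) with j outside the join block), and the explicit ω₀ that
-- fixes the join block and reverses and negates every other block has all of them.  As ω is longest,
-- |Inv(ω)| ≥ |Inv(ω₀)|, whence Inv(ω) = Inv(ω₀) and ω = ω₀.  Finally, the cross inversions of π ω₀
-- are the cross pairs that are not inversions of π, so Inv(u) ⊆ Inv(v) gives Inv(v ω) ⊆ Inv(u ω).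

open import Defs
open import Data.Nat using (ℕ)
open import Data.Bool using (Bool)
open import Data.List using (List)

open import Data.Nat as ℕ using (zero; suc; z≤n; s≤s; _+_; _∸_; _⊔_; _⊓_)
import Data.Nat.Properties as ℕP
open import Data.Nat.Tactic.RingSolver using (solve-∀)
open import Data.Integer as ℤ using (ℤ; +_; -[1+_]; ∣_∣)
import Data.Integer.Properties as ℤP
open import Data.Fin as F using (Fin; toℕ; fromℕ<)
import Data.Fin.Properties as FP
open import Data.Vec as V using (Vec; []; _∷_)
import Data.Vec.Properties as VP
open import Data.List as L using ([]; _∷_; length; _++_; [_])
import Data.List.Properties as LP
open import Data.List.Membership.Propositional using (_∈_)
open import Data.List.Membership.DecPropositional ℕP._≟_ using (_∈?_)
open import Data.List.Relation.Unary.Any using (here; there)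
open import Data.List.Relation.Unary.All using (All; _∷_)
open import Data.Bool using (true; false; if_then_else_)
open import Relation.Nullary.Decidable using (⌊_⌋; _×-dec_)
import Data.Bool.Properties as BoolP
open import Data.Product using (Σ; _×_; _,_; proj₁; proj₂)
open import Data.Sum using (_⊎_; inj₁; inj₂)
import Data.Sum
open import Data.Empty using (⊥-elim)
open import Function using (_∘_)
open import Relation.Nullary using (¬_; Dec; yes; no)
open import Relation.Binary using (tri<; tri≈; tri>)
open import Relation.Binary.PropositionalEquality hiding ([_])

≮∧≢⇒> : ∀ {a b : ℤ} → ¬ (a ℤ.< b) → a ≢ b → b ℤ.< a
≮∧≢⇒> a≮b a≢b = ℤP.≤∧≢⇒< (ℤP.≮⇒≥ a≮b) (a≢b ∘ sym)

0<i<j⇒∣i∣<∣j∣ : ∀ {i j : ℤ} → + 0 ℤ.< i → i ℤ.< j → ∣ i ∣ ℕ.< ∣ j ∣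
0<i<j⇒∣i∣<∣j∣ {+ _} {+ _} _ (ℤ.+<+ i<j) = i<j

i<-j⇒j<-i : ∀ {i j : ℤ} → i ℤ.< ℤ.- j → j ℤ.< ℤ.- i
i<-j⇒j<-i {i} {j} h = subst (ℤ._< ℤ.- i) (ℤP.neg-involutive j) (ℤP.neg-mono-< h)

-i<j⇒-j<i : ∀ {i j : ℤ} → ℤ.- i ℤ.< j → ℤ.- j ℤ.< i
-i<j⇒-j<i {i} {j} h = subst (ℤ.- j ℤ.<_) (ℤP.neg-involutive i) (ℤP.neg-mono-< h)

-n<0 : ∀ n → 1 ℕ.≤ n → ℤ.- (+ n) ℤ.< + 0
-n<0 (suc n) _ = ℤ.-<+

i<j<0⇒∣j∣<∣i∣ : ∀ {i j : ℤ} → i ℤ.< j → j ℤ.< + 0 → ∣ j ∣ ℕ.< ∣ i ∣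
i<j<0⇒∣j∣<∣i∣ (ℤ.-<- p) _ = s≤s p
i<j<0⇒∣j∣<∣i∣ ℤ.-<+ (ℤ.+<+ ())
i<j<0⇒∣j∣<∣i∣ (ℤ.+<+ _) (ℤ.+<+ ())

j<i<-j⇒∣i∣<∣j∣ : ∀ {i j : ℤ} → j ℤ.< i → i ℤ.< ℤ.- j → ∣ i ∣ ℕ.< ∣ j ∣
j<i<-j⇒∣i∣<∣j∣ {+ i} { -[1+ j ]} _ (ℤ.+<+ p) = p
j<i<-j⇒∣i∣<∣j∣ { -[1+ i ]} { -[1+ j ]} (ℤ.-<- p) _ = s≤s p
j<i<-j⇒∣i∣<∣j∣ {+ i} {+ zero} (ℤ.+<+ p) (ℤ.+<+ ())
j<i<-j⇒∣i∣<∣j∣ {+ i} {+ suc j} (ℤ.+<+ p) ()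
j<i<-j⇒∣i∣<∣j∣ { -[1+ i ]} {+ j} () q

i<0⇒i≡-∣i∣ : ∀ {i : ℤ} → i ℤ.< + 0 → i ≡ ℤ.- (+ ∣ i ∣)
i<0⇒i≡-∣i∣ { -[1+ m ]} _ = refl
i<0⇒i≡-∣i∣ {+ m} (ℤ.+<+ ())

-- Signed permutations as functions on positions

at-map-apply : ∀ {n m} (π : SPerm n) (σ : SPerm m) k → at (V.map (apply π) σ) k ≡ apply π (at σ k)
at-map-apply π [] k = refl
at-map-apply π (x ∷ σ) zero = refl
at-map-apply π (x ∷ σ) (suc k) = at-map-apply π σ k

apply-neg : ∀ {n} (π : SPerm n) z → apply π (ℤ.- z) ≡ ℤ.- apply π z
apply-neg π (+ zero) = refl
apply-neg π (+ suc k) = refl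
apply-neg π -[1+ k ] = sym (ℤP.neg-involutive _)

apply-· : ∀ {n} (π σ : SPerm n) z → apply (π · σ) z ≡ apply π (apply σ z)
apply-· π σ (+ zero) = refl
apply-· π σ (+ suc k) = at-map-apply π σ k
apply-· π σ -[1+ k ] = trans (cong ℤ.-_ (at-map-apply π σ k)) (sym (apply-neg π (at σ k)))

·-assoc : ∀ {n} (π σ τ : SPerm n) → π · (σ · τ) ≡ (π · σ) · τ
·-assoc π σ τ = trans (sym (VP.map-∘ (apply π) (apply σ) τ)) (VP.map-cong (λ z → sym (apply-· π σ z)) τ)

at-extensionality : ∀ {n} (u v : Vec ℤ n) → (∀ k → k ℕ.< n → at u k ≡ at v k) → u ≡ v
at-extensionality [] [] h = refl
at-extensionality (x ∷ u) (y ∷ v) h =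
  cong₂ _∷_ (h zero (s≤s z≤n)) (at-extensionality u v (λ k k< → h (suc k) (s≤s k<)))

at-tabulate : ∀ {n} (g : Fin n → ℤ) (G : ℕ → ℤ) → (∀ j → g j ≡ G (toℕ j)) →
  ∀ k → k ℕ.< n → at (V.tabulate g) k ≡ G k
at-tabulate {suc n} g G h zero k< = h F.zero
at-tabulate {suc n} g G h (suc k) (s≤s k<) = at-tabulate (g ∘ F.suc) (G ∘ suc) (h ∘ F.suc) k k<

at-idPerm : ∀ n k → k ℕ.< n → at (idPerm n) k ≡ + suc k
at-idPerm n = at-tabulate _ (λ m → + suc m) (λ j → refl)

·-identityʳ : ∀ {n} (π : SPerm n) → π · idPerm n ≡ π
·-identityʳ {n} π =
  at-extensionality _ _ (λ k k< → trans (at-map-apply π (idPerm n) k) (cong (apply π) (at-idPerm n k k<)))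

lookup≡at : ∀ {n} (π : SPerm n) (i : Fin n) → V.lookup π i ≡ at π (toℕ i)
lookup≡at (x ∷ π) F.zero = refl
lookup≡at (x ∷ π) (F.suc i) = lookup≡at π i

-- IsSignedPerm π in terms of the position function k ↦ π(k + 1)
IsSignedPermFn : ℕ → (ℕ → ℤ) → Set
IsSignedPermFn n f = (∀ k → k ℕ.< n → (1 ℕ.≤ ∣ f k ∣) × (∣ f k ∣ ℕ.≤ n)) ×
                     (∀ k l → k ℕ.< n → l ℕ.< n → ∣ f k ∣ ≡ ∣ f l ∣ → k ≡ l)

IsSignedPerm⇒Fn : ∀ {n} (π : SPerm n) → IsSignedPerm π → IsSignedPermFn n (at π)
IsSignedPerm⇒Fn {n} π (bounded , injective) = bounded′ , injective′
  where
  at≡lookup : ∀ k (k< : k ℕ.< n) → at π k ≡ V.lookup π (fromℕ< k<)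
  at≡lookup k k< = trans (cong (at π) (sym (FP.toℕ-fromℕ< k<))) (sym (lookup≡at π (fromℕ< k<)))
  bounded′ : ∀ k → k ℕ.< n → (1 ℕ.≤ ∣ at π k ∣) × (∣ at π k ∣ ℕ.≤ n)
  bounded′ k k< rewrite at≡lookup k k< = bounded (fromℕ< k<)
  injective′ : ∀ k l → k ℕ.< n → l ℕ.< n → ∣ at π k ∣ ≡ ∣ at π l ∣ → k ≡ l
  injective′ k l k< l< h rewrite at≡lookup k k< | at≡lookup l l< =
    trans (sym (FP.toℕ-fromℕ< k<)) (trans (cong toℕ (injective _ _ h)) (FP.toℕ-fromℕ< l<))

Fn⇒IsSignedPerm : ∀ {n} (π : SPerm n) → IsSignedPermFn n (at π) → IsSignedPerm π
Fn⇒IsSignedPerm {n} π (bounded , injective) = bounded′ , injective′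
  where
  bounded′ : ∀ i → (1 ℕ.≤ ∣ V.lookup π i ∣) × (∣ V.lookup π i ∣ ℕ.≤ n)
  bounded′ i rewrite lookup≡at π i = bounded (toℕ i) (FP.toℕ<n i)
  injective′ : ∀ i j → ∣ V.lookup π i ∣ ≡ ∣ V.lookup π j ∣ → i ≡ j
  injective′ i j h rewrite lookup≡at π i | lookup≡at π j =
    FP.toℕ-injective (injective _ _ (FP.toℕ<n i) (FP.toℕ<n j) h)

IsSignedPermFn-cong : ∀ n f g → (∀ k → k ℕ.< n → f k ≡ g k) → IsSignedPermFn n f → IsSignedPermFn n g
IsSignedPermFn-cong n f g e (bounded , injective) =
  (λ k k< → subst (λ z → (1 ℕ.≤ ∣ z ∣) × (∣ z ∣ ℕ.≤ n)) (e k k<) (bounded k k<)) ,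
  (λ k l k< l< h → injective k l k< l< (trans (cong ∣_∣ (e k k<)) (trans h (cong ∣_∣ (sym (e l l<))))))

≢0 : ∀ {n} f → IsSignedPermFn n f → ∀ k → k ℕ.< n → f k ≢ + 0
≢0 f (bounded , _) k k< eq = ℕP.<-irrefl refl (subst (λ z → 1 ℕ.≤ ∣ z ∣) eq (proj₁ (bounded k k<)))

≢neighbour : ∀ {n} f → IsSignedPermFn n f → ∀ k → suc k ℕ.< n → f (suc k) ≢ f k
≢neighbour f (_ , injective) k k< eq =
  ℕP.<-irrefl refl (subst (k ℕ.<_) (injective (suc k) k k< (ℕP.<-trans (ℕP.n<1+n k) k<) (cong ∣_∣ eq)) (ℕP.n<1+n k))

-- Right multiplication by the simple generators

transposition : ℕ → ℕ → ℕ
transposition zero zero = 1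
transposition zero (suc zero) = 0
transposition zero (suc (suc k)) = suc (suc k)
transposition (suc i) zero = 0
transposition (suc i) (suc k) = suc (transposition i k)

transposition-involutive : ∀ i k → transposition i (transposition i k) ≡ k
transposition-involutive zero zero = refl
transposition-involutive zero (suc zero) = refl
transposition-involutive zero (suc (suc k)) = refl
transposition-involutive (suc i) zero = refl
transposition-involutive (suc i) (suc k) = cong suc (transposition-involutive i k)

transposition-< : ∀ i k n → suc i ℕ.< n → k ℕ.< n → transposition i k ℕ.< n
transposition-< zero zero n i< k< = i<
transposition-< zero (suc zero) n i< k< = ℕP.<-trans (s≤s z≤n) i<
transposition-< zero (suc (suc k)) n i< k< = k<
transposition-< (suc i) zero n i< k< = k<
transposition-< (suc i) (suc k) (suc n) (s≤s i<) (s≤s k<) = s≤s (transposition-< i k n i< k<)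

transposition-left : ∀ i → transposition i i ≡ suc i
transposition-left zero = refl
transposition-left (suc i) = cong suc (transposition-left i)

transposition-right : ∀ i → transposition i (suc i) ≡ i
transposition-right zero = refl
transposition-right (suc i) = cong suc (transposition-right i)

transposition-fixed : ∀ i k → k ≢ i → k ≢ suc i → transposition i k ≡ k
transposition-fixed zero zero k≢i _ = ⊥-elim (k≢i refl)
transposition-fixed zero (suc zero) _ k≢si = ⊥-elim (k≢si refl)
transposition-fixed zero (suc (suc k)) _ _ = refl
transposition-fixed (suc i) zero _ _ = refl
transposition-fixed (suc i) (suc k) k≢i k≢si =
  cong suc (transposition-fixed i k (k≢i ∘ cong suc) (k≢si ∘ cong suc))

negateFirst : (ℕ → ℤ) → ℕ → ℤ
negateFirst f zero = ℤ.- f 0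
negateFirst f (suc k) = f (suc k)

rightAct : ∀ {n} → Fin n → (ℕ → ℤ) → ℕ → ℤ
rightAct F.zero f = negateFirst f
rightAct (F.suc s) f = f ∘ transposition (toℕ s)

rightAct-cong : ∀ {n} (s : Fin n) f g → (∀ k → k ℕ.< n → f k ≡ g k) →
  ∀ k → k ℕ.< n → rightAct s f k ≡ rightAct s g k
rightAct-cong F.zero f g e zero k< = cong ℤ.-_ (e 0 k<)
rightAct-cong F.zero f g e (suc k) k< = e (suc k) k<
rightAct-cong {suc n} (F.suc s) f g e k k< =
  e _ (transposition-< (toℕ s) k (suc n) (s≤s (FP.toℕ<n s)) k<)

rightAct-involutive : ∀ {n} (s : Fin n) f k → rightAct s (rightAct s f) k ≡ f k
rightAct-involutive F.zero f zero = ℤP.neg-involutive _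
rightAct-involutive F.zero f (suc k) = refl
rightAct-involutive (F.suc s) f k = cong f (transposition-involutive (toℕ s) k)

apply-rightAct : ∀ {n} (π : SPerm n) (s : Fin n) f k → apply π (rightAct s f k) ≡ rightAct s (apply π ∘ f) k
apply-rightAct π F.zero f zero = apply-neg π (f 0)
apply-rightAct π F.zero f (suc k) = refl
apply-rightAct π (F.suc s) f k = refl

at-gen : ∀ {n} (s : Fin n) k → k ℕ.< n → at (gen s) k ≡ rightAct s (at (idPerm n)) k
at-gen {suc n} F.zero zero k< = refl
at-gen {suc n} F.zero (suc k) k< =
  trans (at-tabulate _ (λ m → if ⌊ m ℕ.≟ 0 ⌋ then ℤ.- (+ 1) else + suc m) (λ j → refl) (suc k) k<)
        (sym (at-idPerm (suc n) (suc k) k<))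
at-gen {suc n} (F.suc s) k k< =
  trans (at-tabulate _ swapped (λ j → refl) k k<)
        (trans swapped≡ (sym (at-idPerm (suc n) _ (transposition-< i k (suc n) (s≤s (FP.toℕ<n s)) k<))))
  where
  i = toℕ s
  swapped : ℕ → ℤ
  swapped m = if ⌊ m ℕ.≟ i ⌋ then + suc (suc i) else if ⌊ m ℕ.≟ suc i ⌋ then + suc i else + suc m
  swapped≡ : swapped k ≡ + suc (transposition i k)
  swapped≡ with k ℕ.≟ i
  ... | yes refl = cong (+_ ∘ suc) (sym (transposition-left k))
  ... | no k≢i with k ℕ.≟ suc i
  ... | yes refl = cong (+_ ∘ suc) (sym (transposition-right i))
  ... | no k≢si = cong (+_ ∘ suc) (sym (transposition-fixed i k k≢i k≢si))

at-·gen : ∀ {n} (π : SPerm n) (s : Fin n) k → k ℕ.< n → at (π · gen s) k ≡ rightAct s (at π) k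
at-·gen {n} π s k k< = begin
  at (π · gen s) k                          ≡⟨ at-map-apply π (gen s) k ⟩
  apply π (at (gen s) k)                    ≡⟨ cong (apply π) (at-gen s k k<) ⟩
  apply π (rightAct s (at (idPerm n)) k)    ≡⟨ apply-rightAct π s (at (idPerm n)) k ⟩
  rightAct s (apply π ∘ at (idPerm n)) k    ≡⟨ rightAct-cong s _ (at π) (λ j j< → cong (apply π) (at-idPerm n j j<)) k k< ⟩
  rightAct s (at π) k                       ∎
  where open ≡-Reasoning

idPerm-·-gen : ∀ {n} (s : Fin n) → idPerm n · gen s ≡ gen s
idPerm-·-gen {n} s = at-extensionality _ _ (λ k k< → trans (at-·gen (idPerm n) s k k<) (sym (at-gen s k k<)))

·gen-involutive : ∀ {n} (π : SPerm n) (s : Fin n) → (π · gen s) · gen s ≡ π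
·gen-involutive π s = at-extensionality _ _ λ k k< →
  trans (at-·gen (π · gen s) s k k<)
        (trans (rightAct-cong s _ _ (at-·gen π s) k k<) (rightAct-involutive s (at π) k))

eval-snoc : ∀ {n} (w : List (Fin n)) (s : Fin n) → eval (w ++ [ s ]) ≡ eval w · gen s
eval-snoc [] s = trans (·-identityʳ (gen s)) (sym (idPerm-·-gen s))
eval-snoc (t ∷ w) s = trans (cong (gen t ·_) (eval-snoc w s)) (·-assoc (gen t) (eval w) (gen s))

IsSignedPermFn-rightAct : ∀ {n} (s : Fin n) f → IsSignedPermFn n f → IsSignedPermFn n (rightAct s f)
IsSignedPermFn-rightAct {n} F.zero f (bounded , injective) =
  (λ k k< → subst (λ z → (1 ℕ.≤ z) × (z ℕ.≤ n)) (sym (∣negateFirst∣ k)) (bounded k k<)) ,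
  (λ k l k< l< h → injective k l k< l< (trans (sym (∣negateFirst∣ k)) (trans h (∣negateFirst∣ l))))
  where
  ∣negateFirst∣ : ∀ k → ∣ negateFirst f k ∣ ≡ ∣ f k ∣
  ∣negateFirst∣ zero = ℤP.∣-i∣≡∣i∣ (f 0)
  ∣negateFirst∣ (suc k) = refl
IsSignedPermFn-rightAct {suc n} (F.suc s) f (bounded , injective) =
  (λ k k< → bounded _ (τ-< k k<)) ,
  (λ k l k< l< h → trans (sym (transposition-involutive i k))
     (trans (cong (transposition i) (injective _ _ (τ-< k k<) (τ-< l l<) h)) (transposition-involutive i l)))
  where
  i = toℕ s
  τ-< : ∀ k → k ℕ.< suc n → transposition i k ℕ.< suc n
  τ-< k = transposition-< i k (suc n) (s≤s (FP.toℕ<n s))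

IsSignedPermFn-·gen : ∀ {n} (π : SPerm n) (s : Fin n) → IsSignedPermFn n (at π) → IsSignedPermFn n (at (π · gen s))
IsSignedPermFn-·gen {n} π s sp =
  IsSignedPermFn-cong n _ _ (λ k k< → sym (at-·gen π s k k<)) (IsSignedPermFn-rightAct s (at π) sp)

-- Counting inversions

indicator : ∀ {P : Set} → Dec P → ℕ
indicator (yes _) = 1
indicator (no _) = 0

⟦_<_⟧ : ℤ → ℤ → ℕ
⟦ a < b ⟧ = indicator (a ℤP.<? b)

module _ {a b c d : ℤ} where

  ⟦<⟧-mono : (a ℤ.< b → c ℤ.< d) → ⟦ a < b ⟧ ℕ.≤ ⟦ c < d ⟧
  ⟦<⟧-mono h with a ℤP.<? b | c ℤP.<? d
  ... | yes _ | yes _ = ℕP.≤-refl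
  ... | yes p | no ¬q = ⊥-elim (¬q (h p))
  ... | no _ | _ = z≤n

  ⟦<⟧-reflect : (a ℤ.< b → c ℤ.< d) → ⟦ c < d ⟧ ℕ.≤ ⟦ a < b ⟧ → c ℤ.< d → a ℤ.< b
  ⟦<⟧-reflect h le q with a ℤP.<? b | c ℤP.<? d
  ... | yes p | _ = p
  ... | no _ | yes _ = ⊥-elim (ℕP.<-irrefl refl le)
  ... | no _ | no ¬q = ⊥-elim (¬q q)

⟦<⟧-cong : ∀ {a b c d} → (a ℤ.< b → c ℤ.< d) → (c ℤ.< d → a ℤ.< b) → ⟦ a < b ⟧ ≡ ⟦ c < d ⟧
⟦<⟧-cong h k = ℕP.≤-antisym (⟦<⟧-mono h) (⟦<⟧-mono k)

⟦<⟧-yes : ∀ {a b} → a ℤ.< b → ⟦ a < b ⟧ ≡ 1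
⟦<⟧-yes {a} {b} p with a ℤP.<? b
... | yes _ = refl
... | no ¬p = ⊥-elim (¬p p)

⟦<⟧-no : ∀ {a b} → ¬ (a ℤ.< b) → ⟦ a < b ⟧ ≡ 0
⟦<⟧-no {a} {b} ¬p with a ℤP.<? b
... | yes p = ⊥-elim (¬p p)
... | no _ = refl

⟦<⟧≤1 : ∀ a b → ⟦ a < b ⟧ ℕ.≤ 1
⟦<⟧≤1 a b with a ℤP.<? b
... | yes _ = ℕP.≤-refl
... | no _ = z≤n

-- inversions between an entry of value x and the m entries g 0, …, g (m - 1) to its right
pairInversions : ℕ → ℤ → (ℕ → ℤ) → ℕ
pairInversions zero x g = 0
pairInversions (suc m) x g = ⟦ g 0 < x ⟧ + ⟦ x < ℤ.- g 0 ⟧ + pairInversions m x (g ∘ suc)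

-- |Inv(π)| for π with position function f, position k standing for k + 1
inversions : ℕ → (ℕ → ℤ) → ℕ
inversions zero f = 0
inversions (suc m) f = ⟦ f 0 < + 0 ⟧ + pairInversions m (f 0) (f ∘ suc) + inversions m (f ∘ suc)

inversionNumber : ∀ {n} → SPerm n → ℕ
inversionNumber {n} π = inversions n (at π)

InvSubset : ℕ → (ℕ → ℤ) → (ℕ → ℤ) → Set
InvSubset m f g =
  (∀ i → i ℕ.< m → f i ℤ.< + 0 → g i ℤ.< + 0) ×
  (∀ i j → i ℕ.< j → j ℕ.< m → f j ℤ.< f i → g j ℤ.< g i) ×
  (∀ i j → i ℕ.< j → j ℕ.< m → f i ℤ.< ℤ.- f j → g i ℤ.< ℤ.- g j)

InvSubset-tail : ∀ m f g → InvSubset (suc m) f g → InvSubset m (f ∘ suc) (g ∘ suc)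
InvSubset-tail m f g (sgn , pos , neg) =
  (λ i i< → sgn (suc i) (s≤s i<)) ,
  (λ i j i<j j< → pos (suc i) (suc j) (s≤s i<j) (s≤s j<)) ,
  (λ i j i<j j< → neg (suc i) (suc j) (s≤s i<j) (s≤s j<))

InvSubset-cong : ∀ m f g → (∀ i → i ℕ.< m → f i ≡ g i) → InvSubset m f g
InvSubset-cong m f g e =
  (λ i i< → subst (ℤ._< + 0) (e i i<)) ,
  (λ i j i<j j< → subst₂ ℤ._<_ (e j j<) (e i (ℕP.<-trans i<j j<))) ,
  (λ i j i<j j< → subst₂ (λ a b → a ℤ.< ℤ.- b) (e i (ℕP.<-trans i<j j<)) (e j j<))

InvSubset-trans : ∀ {m f g h} → InvSubset m f g → InvSubset m g h → InvSubset m f h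
InvSubset-trans (b₁ , p₁ , n₁) (b₂ , p₂ , n₂) =
  (λ i i< → b₂ i i< ∘ b₁ i i<) ,
  (λ i j i<j j< → p₂ i j i<j j< ∘ p₁ i j i<j j<) ,
  (λ i j i<j j< → n₂ i j i<j j< ∘ n₁ i j i<j j<)

+-mono-≤-reflect₃ : ∀ {a b c a′ b′ c′} → a ℕ.≤ a′ → b ℕ.≤ b′ → c ℕ.≤ c′ → a′ + b′ + c′ ℕ.≤ a + b + c →
  (a′ ℕ.≤ a) × (b′ ℕ.≤ b) × (c′ ℕ.≤ c)
+-mono-≤-reflect₃ p q r s =
  ℕP.≮⇒≥ (λ a<a′ → ℕP.<-irrefl refl (ℕP.<-≤-trans (ℕP.+-mono-<-≤ (ℕP.+-mono-<-≤ a<a′ q) r) s)) ,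
  ℕP.≮⇒≥ (λ b<b′ → ℕP.<-irrefl refl (ℕP.<-≤-trans (ℕP.+-mono-<-≤ (ℕP.+-mono-≤-< p b<b′) r) s)) ,
  ℕP.≮⇒≥ (λ c<c′ → ℕP.<-irrefl refl (ℕP.<-≤-trans (ℕP.+-mono-≤-< (ℕP.+-mono-≤ p q) c<c′) s))

pairInversions-mono : ∀ m x₁ x₂ g₁ g₂ →
  (∀ j → j ℕ.< m → g₁ j ℤ.< x₁ → g₂ j ℤ.< x₂) →
  (∀ j → j ℕ.< m → x₁ ℤ.< ℤ.- g₁ j → x₂ ℤ.< ℤ.- g₂ j) →
  pairInversions m x₁ g₁ ℕ.≤ pairInversions m x₂ g₂
pairInversions-mono zero x₁ x₂ g₁ g₂ pos neg = z≤n
pairInversions-mono (suc m) x₁ x₂ g₁ g₂ pos neg =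
  ℕP.+-mono-≤ (ℕP.+-mono-≤ (⟦<⟧-mono (pos 0 (s≤s z≤n))) (⟦<⟧-mono (neg 0 (s≤s z≤n))))
    (pairInversions-mono m x₁ x₂ _ _ (λ j → pos (suc j) ∘ s≤s) (λ j → neg (suc j) ∘ s≤s))

pairInversions-reflect : ∀ m x₁ x₂ g₁ g₂ →
  (∀ j → j ℕ.< m → g₁ j ℤ.< x₁ → g₂ j ℤ.< x₂) →
  (∀ j → j ℕ.< m → x₁ ℤ.< ℤ.- g₁ j → x₂ ℤ.< ℤ.- g₂ j) →
  pairInversions m x₂ g₂ ℕ.≤ pairInversions m x₁ g₁ →
  (∀ j → j ℕ.< m → g₂ j ℤ.< x₂ → g₁ j ℤ.< x₁) × (∀ j → j ℕ.< m → x₂ ℤ.< ℤ.- g₂ j → x₁ ℤ.< ℤ.- g₁ j)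
pairInversions-reflect zero x₁ x₂ g₁ g₂ pos neg le = (λ j ()) , (λ j ())
pairInversions-reflect (suc m) x₁ x₂ g₁ g₂ pos neg le = pos′ , neg′
  where
  pos₊ = λ j → pos (suc j) ∘ s≤s
  neg₊ = λ j → neg (suc j) ∘ s≤s
  split = +-mono-≤-reflect₃ (⟦<⟧-mono (pos 0 (s≤s z≤n))) (⟦<⟧-mono (neg 0 (s≤s z≤n)))
            (pairInversions-mono m x₁ x₂ _ _ pos₊ neg₊) le
  rest = pairInversions-reflect m x₁ x₂ _ _ pos₊ neg₊ (proj₂ (proj₂ split))
  pos′ : ∀ j → j ℕ.< suc m → g₂ j ℤ.< x₂ → g₁ j ℤ.< x₁
  pos′ zero _ = ⟦<⟧-reflect (pos 0 (s≤s z≤n)) (proj₁ split)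
  pos′ (suc j) (s≤s j<) = proj₁ rest j j<
  neg′ : ∀ j → j ℕ.< suc m → x₂ ℤ.< ℤ.- g₂ j → x₁ ℤ.< ℤ.- g₁ j
  neg′ zero _ = ⟦<⟧-reflect (neg 0 (s≤s z≤n)) (proj₁ (proj₂ split))
  neg′ (suc j) (s≤s j<) = proj₂ rest j j<

inversions-mono : ∀ m f g → InvSubset m f g → inversions m f ℕ.≤ inversions m g
inversions-mono zero f g h = z≤n
inversions-mono (suc m) f g h@(sgn , pos , neg) =
  ℕP.+-mono-≤ (ℕP.+-mono-≤ (⟦<⟧-mono (sgn 0 (s≤s z≤n)))
    (pairInversions-mono m (f 0) (g 0) _ _ (λ j → pos 0 (suc j) (s≤s z≤n) ∘ s≤s) (λ j → neg 0 (suc j) (s≤s z≤n) ∘ s≤s)))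
    (inversions-mono m _ _ (InvSubset-tail m f g h))

InvSubset-reflect : ∀ m f g → InvSubset m f g → inversions m g ℕ.≤ inversions m f → InvSubset m g f
InvSubset-reflect zero f g h le = (λ i ()) , (λ i j _ ()) , (λ i j _ ())
InvSubset-reflect (suc m) f g h@(sgn , pos , neg) le = sgn′ , pos′ , neg′
  where
  pos₀ = λ j → pos 0 (suc j) (s≤s z≤n) ∘ s≤s
  neg₀ = λ j → neg 0 (suc j) (s≤s z≤n) ∘ s≤s
  split = +-mono-≤-reflect₃ (⟦<⟧-mono (sgn 0 (s≤s z≤n))) (pairInversions-mono m (f 0) (g 0) _ _ pos₀ neg₀)
            (inversions-mono m _ _ (InvSubset-tail m f g h)) le
  first = pairInversions-reflect m (f 0) (g 0) _ _ pos₀ neg₀ (proj₁ (proj₂ split))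
  rest = InvSubset-reflect m _ _ (InvSubset-tail m f g h) (proj₂ (proj₂ split))
  sgn′ : ∀ i → i ℕ.< suc m → g i ℤ.< + 0 → f i ℤ.< + 0
  sgn′ zero _ = ⟦<⟧-reflect (sgn 0 (s≤s z≤n)) (proj₁ split)
  sgn′ (suc i) (s≤s i<) = proj₁ rest i i<
  pos′ : ∀ i j → i ℕ.< j → j ℕ.< suc m → g j ℤ.< g i → f j ℤ.< f i
  pos′ zero (suc j) _ (s≤s j<) = proj₁ first j j<
  pos′ (suc i) (suc j) (s≤s i<j) (s≤s j<) = proj₁ (proj₂ rest) i j i<j j<
  neg′ : ∀ i j → i ℕ.< j → j ℕ.< suc m → g i ℤ.< ℤ.- g j → f i ℤ.< ℤ.- f j
  neg′ zero (suc j) _ (s≤s j<) = proj₂ first j j<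
  neg′ (suc i) (suc j) (s≤s i<j) (s≤s j<) = proj₂ (proj₂ rest) i j i<j j<

inversions-cong : ∀ m f g → (∀ i → i ℕ.< m → f i ≡ g i) → inversions m f ≡ inversions m g
inversions-cong m f g e = ℕP.≤-antisym (inversions-mono m f g (InvSubset-cong m f g e))
  (inversions-mono m g f (InvSubset-cong m g f (λ i i< → sym (e i i<))))

pairInversions-swap : ∀ i m x g → suc i ℕ.< m → pairInversions m x (g ∘ transposition i) ≡ pairInversions m x g
pairInversions-swap zero (suc zero) x g (s≤s ())
pairInversions-swap zero (suc (suc m)) x g _ = shuffle ⟦ g 1 < x ⟧ ⟦ x < ℤ.- g 1 ⟧ ⟦ g 0 < x ⟧ ⟦ x < ℤ.- g 0 ⟧ _
  where
  shuffle : ∀ a b c d e → a + b + (c + d + e) ≡ c + d + (a + b + e)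
  shuffle = solve-∀
pairInversions-swap (suc i) (suc m) x g (s≤s i<) =
  cong (_+_ (⟦ g 0 < x ⟧ + ⟦ x < ℤ.- g 0 ⟧)) (pairInversions-swap i m x (g ∘ suc) i<)

inversions-swap : ∀ i m f → suc i ℕ.< m →
  inversions m (f ∘ transposition i) + ⟦ f (suc i) < f i ⟧ ≡ inversions m f + ⟦ f i < f (suc i) ⟧
inversions-swap zero (suc zero) f (s≤s ())
inversions-swap zero (suc (suc m)) f _ = begin
  ⟦ f 1 < + 0 ⟧ + (⟦ f 0 < f 1 ⟧ + ⟦ f 1 < ℤ.- f 0 ⟧ + R₁) + (⟦ f 0 < + 0 ⟧ + R₀ + N) + ⟦ f 1 < f 0 ⟧
    ≡⟨ cong (λ z → ⟦ f 1 < + 0 ⟧ + (⟦ f 0 < f 1 ⟧ + z + R₁) + (⟦ f 0 < + 0 ⟧ + R₀ + N) + ⟦ f 1 < f 0 ⟧)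
            (⟦<⟧-cong i<-j⇒j<-i i<-j⇒j<-i) ⟩
  ⟦ f 1 < + 0 ⟧ + (⟦ f 0 < f 1 ⟧ + ⟦ f 0 < ℤ.- f 1 ⟧ + R₁) + (⟦ f 0 < + 0 ⟧ + R₀ + N) + ⟦ f 1 < f 0 ⟧
    ≡⟨ shuffle ⟦ f 1 < + 0 ⟧ ⟦ f 0 < f 1 ⟧ ⟦ f 0 < ℤ.- f 1 ⟧ R₁ ⟦ f 0 < + 0 ⟧ R₀ N ⟦ f 1 < f 0 ⟧ ⟩
  ⟦ f 0 < + 0 ⟧ + (⟦ f 1 < f 0 ⟧ + ⟦ f 0 < ℤ.- f 1 ⟧ + R₀) + (⟦ f 1 < + 0 ⟧ + R₁ + N) + ⟦ f 0 < f 1 ⟧ ∎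
  where
  open ≡-Reasoning
  R₀ = pairInversions m (f 0) (f ∘ suc ∘ suc)
  R₁ = pairInversions m (f 1) (f ∘ suc ∘ suc)
  N = inversions m (f ∘ suc ∘ suc)
  shuffle : ∀ b₁ p₁₀ n r₁ b₀ r₀ N p₀₁ →
    b₁ + (p₁₀ + n + r₁) + (b₀ + r₀ + N) + p₀₁ ≡ b₀ + (p₀₁ + n + r₀) + (b₁ + r₁ + N) + p₁₀
  shuffle = solve-∀
inversions-swap (suc i) (suc m) f (s≤s i<) = begin
  b + pairInversions m (f 0) (g ∘ transposition i) + inversions m (g ∘ transposition i) + ⟦ g (suc i) < g i ⟧
    ≡⟨ ℕP.+-assoc (b + _) _ _ ⟩
  b + pairInversions m (f 0) (g ∘ transposition i) + (inversions m (g ∘ transposition i) + ⟦ g (suc i) < g i ⟧)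
    ≡⟨ cong₂ (λ r s → b + r + s) (pairInversions-swap i m (f 0) g i<) (inversions-swap i m g i<) ⟩
  b + pairInversions m (f 0) g + (inversions m g + ⟦ g i < g (suc i) ⟧)
    ≡⟨ ℕP.+-assoc (b + _) _ _ ⟨
  b + pairInversions m (f 0) g + inversions m g + ⟦ g i < g (suc i) ⟧ ∎
  where
  open ≡-Reasoning
  b = ⟦ f 0 < + 0 ⟧
  g = f ∘ suc

pairInversions-neg : ∀ m x g → pairInversions m (ℤ.- x) g ≡ pairInversions m x g
pairInversions-neg zero x g = refl
pairInversions-neg (suc m) x g =
  cong₂ _+_ (trans (cong₂ _+_ (⟦<⟧-cong {g 0} {ℤ.- x} {x} {ℤ.- g 0} i<-j⇒j<-i i<-j⇒j<-i)
                                (⟦<⟧-cong {ℤ.- x} {ℤ.- g 0} {g 0} {x} ℤP.neg-cancel-< ℤP.neg-mono-<))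
                   (ℕP.+-comm ⟦ x < ℤ.- g 0 ⟧ _))
            (pairInversions-neg m x (g ∘ suc))

inversions-negateFirst : ∀ m f → inversions (suc m) (negateFirst f) + ⟦ f 0 < + 0 ⟧ ≡ inversions (suc m) f + ⟦ + 0 < f 0 ⟧
inversions-negateFirst m f = begin
  ⟦ ℤ.- f 0 < + 0 ⟧ + pairInversions m (ℤ.- f 0) (f ∘ suc) + N + ⟦ f 0 < + 0 ⟧
    ≡⟨ cong₂ (λ a r → a + r + N + ⟦ f 0 < + 0 ⟧) (⟦<⟧-cong {ℤ.- f 0} {+ 0} {+ 0} {f 0} ℤP.neg-cancel-< ℤP.neg-mono-<)
             (pairInversions-neg m (f 0) (f ∘ suc)) ⟩
  ⟦ + 0 < f 0 ⟧ + pairInversions m (f 0) (f ∘ suc) + N + ⟦ f 0 < + 0 ⟧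
    ≡⟨ shuffle ⟦ + 0 < f 0 ⟧ _ N ⟦ f 0 < + 0 ⟧ ⟩
  ⟦ f 0 < + 0 ⟧ + pairInversions m (f 0) (f ∘ suc) + N + ⟦ + 0 < f 0 ⟧ ∎
  where
  open ≡-Reasoning
  N = inversions m (f ∘ suc)
  shuffle : ∀ a b c d → a + b + c + d ≡ d + b + c + a
  shuffle = solve-∀

-- The weak order through inversion sets of position functions

≤weak⇒InvSubset : ∀ {n} {u v : SPerm n} → u ≤weak v → InvSubset n (at u) (at v)
≤weak⇒InvSubset u≤v =
  (λ i i< neg → proj₂ (proj₂ (u≤v (bar (suc i)) (s≤s z≤n , i< , neg)))) ,
  (λ i j i<j j< inv → proj₂ (proj₂ (proj₂ (u≤v (posPair (suc i) (suc j)) (s≤s z≤n , s≤s i<j , j< , inv))))) ,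
  (λ i j i<j j< inv → proj₂ (proj₂ (proj₂ (u≤v (negPair (suc j) (suc i)) (s≤s z≤n , s≤s i<j , j< , inv)))))

InvSubset⇒≤weak : ∀ {n} {u v : SPerm n} → InvSubset n (at u) (at v) → u ≤weak v
InvSubset⇒≤weak (sign , pos , neg) (bar (suc i)) (1≤ , i< , inv) = 1≤ , i< , sign i i< inv
InvSubset⇒≤weak (sign , pos , neg) (posPair (suc i) (suc j)) (1≤ , s≤s i<j , j< , inv) = 1≤ , s≤s i<j , j< , pos i j i<j j< inv
InvSubset⇒≤weak (sign , pos , neg) (negPair (suc j) (suc i)) (1≤ , s≤s i<j , j< , inv) = 1≤ , s≤s i<j , j< , neg i j i<j j< inv

-- Descents and the Coxeter length

descentPair : ∀ {n} → Fin n → (ℕ → ℤ) → ℤ × ℤ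
descentPair F.zero f = f 0 , + 0
descentPair (F.suc s) f = f (suc (toℕ s)) , f (toℕ s)

IsDescent : ∀ {n} → (ℕ → ℤ) → Fin n → Set
IsDescent f s = proj₁ (descentPair s f) ℤ.< proj₂ (descentPair s f)

isDescent? : ∀ {n} f (s : Fin n) → Dec (IsDescent f s)
isDescent? f s = proj₁ (descentPair s f) ℤP.<? proj₂ (descentPair s f)

descentPair-≢ : ∀ {n} f (s : Fin n) → IsSignedPermFn n f → proj₁ (descentPair s f) ≢ proj₂ (descentPair s f)
descentPair-≢ {suc n} f F.zero sp = ≢0 f sp 0 (s≤s z≤n)
descentPair-≢ {suc n} f (F.suc s) sp = ≢neighbour f sp (toℕ s) (s≤s (FP.toℕ<n s))

inversions-rightAct : ∀ {n} (s : Fin n) f →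
  inversions n (rightAct s f) + ⟦ proj₁ (descentPair s f) < proj₂ (descentPair s f) ⟧ ≡
  inversions n f + ⟦ proj₂ (descentPair s f) < proj₁ (descentPair s f) ⟧
inversions-rightAct {suc m} F.zero f = inversions-negateFirst m f
inversions-rightAct {suc m} (F.suc s) f = inversions-swap (toℕ s) (suc m) f (s≤s (FP.toℕ<n s))

inversionNumber-·gen : ∀ {n} (π : SPerm n) (s : Fin n) →
  inversionNumber (π · gen s) + ⟦ proj₁ (descentPair s (at π)) < proj₂ (descentPair s (at π)) ⟧ ≡
  inversionNumber π + ⟦ proj₂ (descentPair s (at π)) < proj₁ (descentPair s (at π)) ⟧
inversionNumber-·gen {n} π s =
  trans (cong₂ _+_ (inversions-cong n _ _ (at-·gen π s)) refl) (inversions-rightAct s (at π))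

inversionNumber-·gen-descent : ∀ {n} (π : SPerm n) (s : Fin n) → IsDescent (at π) s →
  inversionNumber (π · gen s) + 1 ≡ inversionNumber π
inversionNumber-·gen-descent π s d =
  trans (cong (_+_ (inversionNumber (π · gen s))) (sym (⟦<⟧-yes d)))
    (trans (inversionNumber-·gen π s)
      (trans (cong (_+_ (inversionNumber π)) (⟦<⟧-no (ℤP.<-asym d))) (ℕP.+-identityʳ _)))

inversionNumber-·gen-ascent : ∀ {n} (π : SPerm n) (s : Fin n) → IsSignedPermFn n (at π) → ¬ IsDescent (at π) s →
  inversionNumber (π · gen s) ≡ inversionNumber π + 1
inversionNumber-·gen-ascent π s sp ¬d =
  trans (sym (ℕP.+-identityʳ _))
    (trans (cong (_+_ (inversionNumber (π · gen s))) (sym (⟦<⟧-no ¬d)))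
      (trans (inversionNumber-·gen π s)
        (cong (_+_ (inversionNumber π)) (⟦<⟧-yes (≮∧≢⇒> ¬d (descentPair-≢ (at π) s sp))))))

inversionNumber-·gen-≤ : ∀ {n} (π : SPerm n) (s : Fin n) → inversionNumber (π · gen s) ℕ.≤ inversionNumber π + 1
inversionNumber-·gen-≤ π s = begin
  inversionNumber (π · gen s)         ≤⟨ ℕP.m≤m+n _ _ ⟩
  inversionNumber (π · gen s) + _     ≡⟨ inversionNumber-·gen π s ⟩
  inversionNumber π + _               ≤⟨ ℕP.+-monoʳ-≤ (inversionNumber π) (⟦<⟧≤1 _ _) ⟩
  inversionNumber π + 1               ∎
  where open ℕP.≤-Reasoning

pairInversions-positive-increasing : ∀ m x g → + 0 ℤ.< x → (∀ j → j ℕ.< m → x ℤ.< g j) → pairInversions m x g ≡ 0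
pairInversions-positive-increasing zero x g _ _ = refl
pairInversions-positive-increasing (suc m) x g 0<x x<g =
  cong₂ _+_ (cong₂ _+_ (⟦<⟧-no (ℤP.<-asym (x<g 0 (s≤s z≤n))))
                       (⟦<⟧-no (λ x<-g₀ → ℤP.<-asym 0<x (ℤP.<-trans x<-g₀ (ℤP.neg-mono-< (ℤP.<-trans 0<x (x<g 0 (s≤s z≤n))))))))
            (pairInversions-positive-increasing m x (g ∘ suc) 0<x (λ j → x<g (suc j) ∘ s≤s))

inversions-positive-increasing : ∀ m f → (∀ k → k ℕ.< m → + 0 ℤ.< f k) →
  (∀ i j → i ℕ.< j → j ℕ.< m → f i ℤ.< f j) → inversions m f ≡ 0
inversions-positive-increasing zero f _ _ = refl
inversions-positive-increasing (suc m) f pos inc =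
  cong₂ _+_ (cong₂ _+_ (⟦<⟧-no (ℤP.<-asym (pos 0 (s≤s z≤n))))
                       (pairInversions-positive-increasing m (f 0) _ (pos 0 (s≤s z≤n)) (λ j → inc 0 (suc j) (s≤s z≤n) ∘ s≤s)))
            (inversions-positive-increasing m (f ∘ suc) (λ k → pos (suc k) ∘ s≤s)
              (λ i j i<j j< → inc (suc i) (suc j) (s≤s i<j) (s≤s j<)))

inversionNumber-idPerm : ∀ n → inversionNumber (idPerm n) ≡ 0
inversionNumber-idPerm n = trans (inversions-cong n _ _ (at-idPerm n))
  (inversions-positive-increasing n (λ k → + suc k) (λ k _ → ℤ.+<+ (s≤s z≤n)) (λ i j i<j _ → ℤ.+<+ (s≤s i<j)))

increasing-bounded⇒≡suc : ∀ n (c : ℕ → ℕ) → (∀ k → suc k ℕ.< n → c k ℕ.< c (suc k)) →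
  (∀ k → k ℕ.< n → (1 ℕ.≤ c k) × (c k ℕ.≤ n)) → ∀ k → k ℕ.< n → c k ≡ suc k
increasing-bounded⇒≡suc n c inc bounded k k< = ℕP.≤-antisym (above (n ℕ.∸ suc k) k (ℕP.m+[n∸m]≡n k<)) (below k k<)
  where
  below : ∀ k → k ℕ.< n → suc k ℕ.≤ c k
  below zero k< = proj₁ (bounded 0 k<)
  below (suc k) k< = ℕP.<-≤-trans (s≤s (below k (ℕP.<-trans (ℕP.n<1+n k) k<))) (inc k k<)
  above : ∀ d k → suc k + d ≡ n → c k ℕ.≤ suc k
  above zero k e = subst (c k ℕ.≤_) (trans (sym e) (ℕP.+-identityʳ _))
    (proj₂ (bounded k (ℕP.≤-reflexive (trans (sym (ℕP.+-identityʳ _)) e))))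
  above (suc d) k e = ℕP.<⇒≤pred (ℕP.<-≤-trans (inc k sk<) (above d (suc k) (trans (sym (ℕP.+-suc (suc k) d)) e)))
    where
    sk< : suc (suc k) ℕ.≤ n
    sk< = subst (suc (suc k) ℕ.≤_) (trans (sym (ℕP.+-suc (suc k) d)) e) (ℕP.m≤m+n (suc (suc k)) d)

noDescent⇒idPerm : ∀ {n} (π : SPerm n) → IsSignedPermFn n (at π) → (∀ (s : Fin n) → ¬ IsDescent (at π) s) → π ≡ idPerm n
noDescent⇒idPerm {zero} [] _ _ = refl
noDescent⇒idPerm {suc n} π sp noDescent =
  at-extensionality _ _ (λ k k< → trans (sym (ℤP.0≤i⇒+∣i∣≡i (ℤP.<⇒≤ (positive k k<))))
    (trans (cong +_ (∣f∣≡suc k k<)) (sym (at-idPerm (suc n) k k<))))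
  where
  f = at π
  increasing : ∀ k → suc k ℕ.< suc n → f k ℤ.< f (suc k)
  increasing k (s≤s k<) = ≮∧≢⇒> ¬d (≢neighbour f sp k (s≤s k<))
    where
    ¬d : ¬ (f (suc k) ℤ.< f k)
    ¬d = subst (λ j → ¬ (f (suc j) ℤ.< f j)) (FP.toℕ-fromℕ< k<) (noDescent (F.suc (fromℕ< k<)))
  positive : ∀ k → k ℕ.< suc n → + 0 ℤ.< f k
  positive zero _ = ≮∧≢⇒> (noDescent F.zero) (≢0 f sp 0 (s≤s z≤n))
  positive (suc k) k< = ℤP.<-trans (positive k (ℕP.<-trans (ℕP.n<1+n k) k<)) (increasing k k<)
  ∣f∣≡suc : ∀ k → k ℕ.< suc n → ∣ f k ∣ ≡ suc k
  ∣f∣≡suc = increasing-bounded⇒≡suc (suc n) (∣_∣ ∘ f)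
    (λ k k< → 0<i<j⇒∣i∣<∣j∣ (positive k (ℕP.<-trans (ℕP.n<1+n k) k<)) (increasing k k<)) (proj₁ sp)

-- peel right descents off π until none is left
reducedWord : ∀ k {n} (π : SPerm n) → IsSignedPermFn n (at π) → inversionNumber π ≡ k →
  Σ (List (Fin n)) λ w → (eval w ≡ π) × (length w ≡ k)
reducedWord k {n} π sp e with FP.any? (isDescent? (at π))
... | no noDescent = [] , sym π≡id , trans (sym (inversionNumber-idPerm n)) (trans (cong inversionNumber (sym π≡id)) e)
  where
  π≡id = noDescent⇒idPerm π sp (λ s d → noDescent (s , d))
... | yes (s , d) with k | trans (ℕP.+-comm 1 _) (trans (inversionNumber-·gen-descent π s d) e)
... | zero | ()
... | suc k′ | e′ with reducedWord k′ (π · gen s) (IsSignedPermFn-·gen π s sp) (ℕP.suc-injective e′)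
... | w , w≡ , ∣w∣ = w ++ [ s ] , trans (eval-snoc w s) (trans (cong (_· gen s) w≡) (·gen-involutive π s)) ,
      trans (LP.length-++ w) (trans (ℕP.+-comm (length w) 1) (cong suc ∣w∣))

inversionNumber-·eval-≤ : ∀ {n} (w : List (Fin n)) (π : SPerm n) → inversionNumber (π · eval w) ℕ.≤ inversionNumber π + length w
inversionNumber-·eval-≤ [] π = ℕP.≤-trans (ℕP.≤-reflexive (cong inversionNumber (·-identityʳ π))) (ℕP.m≤m+n _ 0)
inversionNumber-·eval-≤ (s ∷ w) π = begin
  inversionNumber (π · (gen s · eval w))   ≡⟨ cong inversionNumber (·-assoc π (gen s) (eval w)) ⟩
  inversionNumber ((π · gen s) · eval w)   ≤⟨ inversionNumber-·eval-≤ w (π · gen s) ⟩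
  inversionNumber (π · gen s) + length w   ≤⟨ ℕP.+-monoˡ-≤ (length w) (inversionNumber-·gen-≤ π s) ⟩
  inversionNumber π + 1 + length w         ≡⟨ ℕP.+-assoc (inversionNumber π) 1 (length w) ⟩
  inversionNumber π + suc (length w)       ∎
  where open ℕP.≤-Reasoning

inversionNumber-eval-≤ : ∀ {n} (w : List (Fin n)) → inversionNumber (eval w) ℕ.≤ length w
inversionNumber-eval-≤ {n} [] = ℕP.≤-reflexive (inversionNumber-idPerm n)
inversionNumber-eval-≤ {n} (s ∷ w) =
  ℕP.≤-trans (inversionNumber-·eval-≤ w (gen s)) (ℕP.+-monoˡ-≤ (length w) gen≤1)
  where
  gen≤1 : inversionNumber (gen s) ℕ.≤ 1
  gen≤1 = subst₂ (λ π k → inversionNumber π ℕ.≤ k + 1) (idPerm-·-gen s) (inversionNumber-idPerm n)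
            (inversionNumber-·gen-≤ (idPerm n) s)

hasLength-inversionNumber : ∀ {n} (π : SPerm n) → IsSignedPermFn n (at π) → HasLength π (inversionNumber π)
hasLength-inversionNumber π sp =
  reducedWord _ π sp refl , λ w w≡π → subst (λ σ → inversionNumber σ ℕ.≤ length w) w≡π (inversionNumber-eval-≤ w)

hasLength⇒≡inversionNumber : ∀ {n} (π : SPerm n) → IsSignedPermFn n (at π) → ∀ k → HasLength π k → k ≡ inversionNumber π
hasLength⇒≡inversionNumber π sp k ((w , w≡π , ∣w∣) , minimal) with reducedWord _ π sp refl
... | w′ , w′≡π , ∣w′∣ = ℕP.≤-antisym (subst (k ℕ.≤_) ∣w′∣ (minimal w′ w′≡π))
  (subst (inversionNumber π ℕ.≤_) ∣w∣ (proj₂ (hasLength-inversionNumber π sp) w w≡π))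

ascent⇒LengthLess : ∀ {n} (π : SPerm n) (s : Fin n) → IsSignedPermFn n (at π) → ¬ IsDescent (at π) s →
  LengthLess π (π · gen s)
ascent⇒LengthLess π s sp ¬d k k′ hk hk′ =
  subst₂ ℕ._<_ (sym (hasLength⇒≡inversionNumber π sp k hk))
    (sym (hasLength⇒≡inversionNumber (π · gen s) (IsSignedPermFn-·gen π s sp) k′ hk′))
    (subst (inversionNumber π ℕ.<_) (sym (inversionNumber-·gen-ascent π s sp ¬d)) (ℕP.m<m+n _ (s≤s z≤n)))

LengthLess⇒ascent : ∀ {n} (π : SPerm n) (s : Fin n) → IsSignedPermFn n (at π) → LengthLess π (π · gen s) →
  ¬ IsDescent (at π) s
LengthLess⇒ascent π s sp less d =
  ℕP.<-asym (subst (inversionNumber (π · gen s) ℕ.<_) (inversionNumber-·gen-descent π s d) (ℕP.m<m+n _ (s≤s z≤n)))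
    (less _ _ (hasLength-inversionNumber π sp) (hasLength-inversionNumber (π · gen s) (IsSignedPermFn-·gen π s sp)))

-- The blocks of a composition

maxBelow : ℕ → List ℕ → ℕ
maxBelow x [] = 0
maxBelow x (p ∷ ps) with p ℕ.<? x
... | yes _ = p ⊔ maxBelow x ps
... | no _ = maxBelow x ps

minAbove : ℕ → ℕ → List ℕ → ℕ
minAbove n x [] = n
minAbove n x (p ∷ ps) with x ℕ.≤? p
... | yes _ = p ⊓ minAbove n x ps
... | no _ = minAbove n x ps

≤-minAbove : ∀ n x P → x ℕ.≤ n → x ℕ.≤ minAbove n x P
≤-minAbove n x [] x≤n = x≤n
≤-minAbove n x (p ∷ ps) x≤n with x ℕ.≤? p
... | yes x≤p = ℕP.⊓-glb x≤p (≤-minAbove n x ps x≤n)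
... | no _ = ≤-minAbove n x ps x≤n

minAbove-≤ : ∀ n x P → minAbove n x P ℕ.≤ n
minAbove-≤ n x [] = ℕP.≤-refl
minAbove-≤ n x (p ∷ ps) with x ℕ.≤? p
... | yes _ = ℕP.≤-trans (ℕP.m⊓n≤n p _) (minAbove-≤ n x ps)
... | no _ = minAbove-≤ n x ps

minAbove-≤-∈ : ∀ n x P p → p ∈ P → x ℕ.≤ p → minAbove n x P ℕ.≤ p
minAbove-≤-∈ n x (q ∷ ps) p (here refl) x≤p with x ℕ.≤? q
... | yes _ = ℕP.m⊓n≤m q _
... | no x≰p = ⊥-elim (x≰p x≤p)
minAbove-≤-∈ n x (q ∷ ps) p (there p∈) x≤p with x ℕ.≤? q
... | yes _ = ℕP.≤-trans (ℕP.m⊓n≤n q _) (minAbove-≤-∈ n x ps p p∈ x≤p)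
... | no _ = minAbove-≤-∈ n x ps p p∈ x≤p

minAbove-∈⊎≡ : ∀ n x P → (minAbove n x P ∈ P) ⊎ (minAbove n x P ≡ n)
minAbove-∈⊎≡ n x [] = inj₂ refl
minAbove-∈⊎≡ n x (p ∷ ps) with x ℕ.≤? p
... | no _ = Data.Sum.map₁ there (minAbove-∈⊎≡ n x ps)
... | yes _ with ℕP.⊓-sel p (minAbove n x ps)
... | inj₁ e = inj₁ (here e)
... | inj₂ e rewrite e = Data.Sum.map₁ there (minAbove-∈⊎≡ n x ps)

maxBelow-< : ∀ x P → 1 ℕ.≤ x → maxBelow x P ℕ.< x
maxBelow-< x [] 1≤x = 1≤x
maxBelow-< x (p ∷ ps) 1≤x with p ℕ.<? x
... | yes p<x = ℕP.⊔-lub p<x (maxBelow-< x ps 1≤x)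
... | no _ = maxBelow-< x ps 1≤x

∈-≤-maxBelow : ∀ x P p → p ∈ P → p ℕ.< x → p ℕ.≤ maxBelow x P
∈-≤-maxBelow x (q ∷ ps) p (here refl) p<x with q ℕ.<? x
... | yes _ = ℕP.m≤m⊔n q _
... | no p≮x = ⊥-elim (p≮x p<x)
∈-≤-maxBelow x (q ∷ ps) p (there p∈) p<x with q ℕ.<? x
... | yes _ = ℕP.≤-trans (∈-≤-maxBelow x ps p p∈ p<x) (ℕP.m≤n⊔m q _)
... | no _ = ∈-≤-maxBelow x ps p p∈ p<x

maxBelow-≡0⊎∈ : ∀ x P → (maxBelow x P ≡ 0) ⊎ (maxBelow x P ∈ P)
maxBelow-≡0⊎∈ x [] = inj₁ refl
maxBelow-≡0⊎∈ x (p ∷ ps) with p ℕ.<? x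
... | no _ = Data.Sum.map₂ there (maxBelow-≡0⊎∈ x ps)
... | yes _ with ℕP.⊔-sel p (maxBelow x ps)
... | inj₁ e = inj₂ (here e)
... | inj₂ e rewrite e = Data.Sum.map₂ there (maxBelow-≡0⊎∈ x ps)

-- The positions 1, …, n cut after each element of P; x lies in the block [start x, end x].
module Blocks (n : ℕ) (P : List ℕ) where

  start : ℕ → ℕ
  start x = suc (maxBelow x P)

  end : ℕ → ℕ
  end x = minAbove n x P

  reflect : ℕ → ℕ
  reflect x = start x + (end x ∸ x)

  InRange : ℕ → Set
  InRange x = (1 ℕ.≤ x) × (x ℕ.≤ n)

  start-≤ : ∀ x → 1 ℕ.≤ x → start x ℕ.≤ x
  start-≤ x = maxBelow-< x P

  ≤-end : ∀ x → x ℕ.≤ n → x ℕ.≤ end x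
  ≤-end x = ≤-minAbove n x P

  end-≤ : ∀ x → end x ℕ.≤ n
  end-≤ x = minAbove-≤ n x P

  sameBlock : ∀ x y → InRange x → start x ℕ.≤ y → y ℕ.≤ end x → (end y ≡ end x) × (start y ≡ start x)
  sameBlock x y (1≤x , x≤n) sx≤y y≤ex = ℕP.≤-antisym ey≤ex ex≤ey , cong suc (ℕP.≤-antisym below≤ ≤below)
    where
    y≤n : y ℕ.≤ n
    y≤n = ℕP.≤-trans y≤ex (end-≤ x)
    ey≤ex : end y ℕ.≤ end x
    ey≤ex with minAbove-∈⊎≡ n x P
    ... | inj₁ ex∈ = minAbove-≤-∈ n y P (end x) ex∈ y≤ex
    ... | inj₂ e = subst (end y ℕ.≤_) (sym e) (end-≤ y)
    ex≤ey : end x ℕ.≤ end y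
    ex≤ey with minAbove-∈⊎≡ n y P
    ... | inj₂ e = subst (end x ℕ.≤_) (sym e) (end-≤ x)
    ... | inj₁ ey∈ with end y ℕ.<? x
    ... | yes ey<x = ⊥-elim (ℕP.<-irrefl refl
          (ℕP.<-≤-trans (s≤s (∈-≤-maxBelow x P (end y) ey∈ ey<x)) (ℕP.≤-trans sx≤y (≤-end y y≤n))))
    ... | no ey≮x = minAbove-≤-∈ n x P (end y) ey∈ (ℕP.≮⇒≥ ey≮x)
    below≤ : maxBelow y P ℕ.≤ maxBelow x P
    below≤ with maxBelow-≡0⊎∈ y P
    ... | inj₁ e = subst (ℕ._≤ maxBelow x P) (sym e) z≤n
    ... | inj₂ m∈ with maxBelow y P ℕ.<? x
    ... | yes m<x = ∈-≤-maxBelow x P _ m∈ m<x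
    ... | no m≮x = ⊥-elim (ℕP.<-irrefl refl (ℕP.<-≤-trans (maxBelow-< y P (ℕP.≤-trans (s≤s z≤n) sx≤y))
                    (ℕP.≤-trans y≤ex (minAbove-≤-∈ n x P _ m∈ (ℕP.≮⇒≥ m≮x)))))
    ≤below : maxBelow x P ℕ.≤ maxBelow y P
    ≤below with maxBelow-≡0⊎∈ x P
    ... | inj₁ e = subst (ℕ._≤ maxBelow y P) (sym e) z≤n
    ... | inj₂ m∈ = ∈-≤-maxBelow y P _ m∈ sx≤y

  end-<-start : ∀ x y → y ℕ.≤ n → end x ℕ.< y → end x ℕ.< start y
  end-<-start x y y≤n ex<y with minAbove-∈⊎≡ n x P
  ... | inj₁ ex∈ = s≤s (∈-≤-maxBelow y P (end x) ex∈ ex<y)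
  ... | inj₂ e = ⊥-elim (ℕP.<-irrefl refl (ℕP.<-≤-trans ex<y (subst (y ℕ.≤_) (sym e) y≤n)))

  reflect-inBlock : ∀ x → InRange x → (start x ℕ.≤ reflect x) × (reflect x ℕ.≤ end x)
  reflect-inBlock x (1≤x , x≤n) = ℕP.m≤m+n (start x) _ ,
    ℕP.≤-trans (ℕP.+-monoˡ-≤ (end x ∸ x) (start-≤ x 1≤x)) (ℕP.≤-reflexive (ℕP.m+[n∸m]≡n (≤-end x x≤n)))

  reflect-sameBlock : ∀ x → InRange x → (end (reflect x) ≡ end x) × (start (reflect x) ≡ start x)
  reflect-sameBlock x r = sameBlock x (reflect x) r (proj₁ (reflect-inBlock x r)) (proj₂ (reflect-inBlock x r))

  reflect-InRange : ∀ x → InRange x → InRange (reflect x)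
  reflect-InRange x r = ℕP.≤-trans (s≤s z≤n) (proj₁ (reflect-inBlock x r)) , ℕP.≤-trans (proj₂ (reflect-inBlock x r)) (end-≤ x)

  reflect-involutive : ∀ x → InRange x → reflect (reflect x) ≡ x
  reflect-involutive x r@(1≤x , x≤n) = begin
    reflect (reflect x)                           ≡⟨ cong₂ (λ a b → a + (b ∸ reflect x)) (proj₂ (reflect-sameBlock x r)) (proj₁ (reflect-sameBlock x r)) ⟩
    start x + (end x ∸ (start x + (end x ∸ x)))   ≡⟨ cong (λ z → start x + (end x ∸ z)) (ℕP.+-comm (start x) _) ⟩
    start x + (end x ∸ ((end x ∸ x) + start x))   ≡⟨ cong (_+_ (start x)) (sym (ℕP.∸-+-assoc (end x) (end x ∸ x) (start x))) ⟩
    start x + ((end x ∸ (end x ∸ x)) ∸ start x)   ≡⟨ cong (λ z → start x + (z ∸ start x)) (ℕP.m∸[m∸n]≡n (≤-end x x≤n)) ⟩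
    start x + (x ∸ start x)                       ≡⟨ ℕP.m+[n∸m]≡n (start-≤ x 1≤x) ⟩
    x                                             ∎
    where open ≡-Reasoning

  reflect-injective : ∀ x y → InRange x → InRange y → reflect x ≡ reflect y → x ≡ y
  reflect-injective x y rx ry e = trans (sym (reflect-involutive x rx)) (trans (cong reflect e) (reflect-involutive y ry))

  reflect-antitone : ∀ x y → InRange x → x ℕ.< y → y ℕ.≤ end x → reflect y ℕ.< reflect x
  reflect-antitone x y r x<y y≤ex with sameBlock x y r (ℕP.≤-trans (start-≤ x (proj₁ r)) (ℕP.<⇒≤ x<y)) y≤ex
  ... | ey≡ex , sy≡sx = subst (ℕ._< reflect x) (sym (cong₂ (λ a b → a + (b ∸ y)) sy≡sx ey≡ex))
                          (ℕP.+-monoʳ-< (start x) (ℕP.∸-monoʳ-< x<y y≤ex))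

  reflect-monotone-across : ∀ x y → InRange x → InRange y → end x ℕ.< y → reflect x ℕ.< reflect y
  reflect-monotone-across x y rx ry ex<y =
    ℕP.≤-<-trans (proj₂ (reflect-inBlock x rx))
      (ℕP.<-≤-trans (end-<-start x y (proj₂ ry) ex<y) (proj₁ (reflect-inBlock y ry)))

  end-∈ : ∀ p → p ∈ P → p ℕ.≤ n → end p ≡ p
  end-∈ p p∈ p≤n = ℕP.≤-antisym (minAbove-≤-∈ n p P p p∈ ℕP.≤-refl) (≤-end p p≤n)

  ∉⇒<-end : ∀ m → m ℕ.< n → ¬ (m ∈ P) → m ℕ.< end m
  ∉⇒<-end m m<n m∉ with ℕP.m≤n⇒m<n∨m≡n (≤-end m (ℕP.<⇒≤ m<n))
  ... | inj₁ m<em = m<em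
  ... | inj₂ m≡em with minAbove-∈⊎≡ n m P
  ... | inj₁ em∈ = ⊥-elim (m∉ (subst (_∈ P) (sym m≡em) em∈))
  ... | inj₂ em≡n = ⊥-elim (ℕP.<-irrefl (trans m≡em em≡n) m<n)

  ∈-end⇒∉ : ∀ x k → x ℕ.≤ k → k ℕ.< end x → ¬ (k ∈ P)
  ∈-end⇒∉ x k x≤k k<ex k∈ = ℕP.<-irrefl refl (ℕP.≤-<-trans (minAbove-≤-∈ n x P k k∈ x≤k) k<ex)

  reflect-suc : ∀ m → InRange m → m ℕ.< end m → suc (reflect (suc m)) ≡ reflect m
  reflect-suc m r m<em with sameBlock m (suc m) r (ℕP.≤-trans (start-≤ m (proj₁ r)) (ℕP.n≤1+n m)) m<em
  ... | e≡ , s≡ = begin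
    suc (start (suc m) + (end (suc m) ∸ suc m))   ≡⟨ cong suc (cong₂ (λ a b → a + (b ∸ suc m)) s≡ e≡) ⟩
    suc (start m + (end m ∸ suc m))               ≡⟨ ℕP.+-suc (start m) _ ⟨
    start m + suc (end m ∸ suc m)                 ≡⟨ cong (_+_ (start m)) (ℕP.+-∸-assoc 1 m<em) ⟨
    start m + (end m ∸ m)                         ∎
    where open ≡-Reasoning

-- InJoin x: x lies in the first block of a join composition, the block merged with its negative.
-- longest x = ω_α(x): the identity on the join block, reversal followed by negation on every other block.
-- composeLongest G x = G(ω_α(x)) for the odd extension of G.
module Longest (n : ℕ) (split : Bool) (P : List ℕ) where
  open Blocks n P public

  InJoin : ℕ → Set
  InJoin x = (split ≡ false) × (x ℕ.≤ end 1)

  inJoin? : ∀ x → Dec (InJoin x)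
  inJoin? x = (split BoolP.≟ false) ×-dec (x ℕ.≤? end 1)

  byJoin : ∀ {A : Set} x → (InJoin x → A) → (¬ InJoin x → A) → A
  byJoin x f g with inJoin? x
  ... | yes j = f j
  ... | no nj = g nj

  composeLongest : (ℕ → ℤ) → ℕ → ℤ
  composeLongest G x = byJoin x (λ _ → G x) (λ _ → ℤ.- G (reflect x))

  composeLongest-join : ∀ G x → InJoin x → composeLongest G x ≡ G x
  composeLongest-join G x j with inJoin? x
  ... | yes _ = refl
  ... | no nj = ⊥-elim (nj j)

  composeLongest-nonjoin : ∀ G x → ¬ InJoin x → composeLongest G x ≡ ℤ.- G (reflect x)
  composeLongest-nonjoin G x nj with inJoin? x
  ... | yes j = ⊥-elim (nj j)
  ... | no _ = refl

  longest : ℕ → ℤ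
  longest = composeLongest (λ x → + x)

  longest-join : ∀ x → InJoin x → longest x ≡ + x
  longest-join = composeLongest-join (λ x → + x)

  longest-nonjoin : ∀ x → ¬ InJoin x → longest x ≡ ℤ.- (+ reflect x)
  longest-nonjoin = composeLongest-nonjoin (λ x → + x)

  start-1 : start 1 ≡ 1
  start-1 = ℕP.≤-antisym (start-≤ 1 ℕP.≤-refl) (s≤s z≤n)

  join-end : ∀ x → InJoin x → 1 ℕ.≤ x → end x ≡ end 1
  join-end x (_ , x≤e1) 1≤x =
    proj₁ (sameBlock 1 x (ℕP.≤-refl , ℕP.≤-trans 1≤x (ℕP.≤-trans x≤e1 (end-≤ 1))) (subst (ℕ._≤ x) (sym start-1) 1≤x) x≤e1)

  join-downward : ∀ x y → InJoin y → x ℕ.≤ y → InJoin x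
  join-downward x y (s , h) le = s , ℕP.≤-trans le h

  end1-<-nonjoin : ∀ x → ¬ InJoin x → split ≡ false → end 1 ℕ.< x
  end1-<-nonjoin x nj s = ℕP.≰⇒> (λ le → nj (s , le))

  nonjoin-upward : ∀ x y → ¬ InJoin x → x ℕ.≤ n → start x ℕ.≤ y → ¬ InJoin y
  nonjoin-upward x y nj x≤n sx≤y (s , y≤e1) =
    ℕP.<-irrefl refl (ℕP.<-≤-trans (end-<-start 1 x x≤n (end1-<-nonjoin x nj s)) (ℕP.≤-trans sx≤y y≤e1))

  join-suc : ∀ k → 1 ℕ.≤ k → InJoin k → k ℕ.< end k → InJoin (suc k)
  join-suc k 1≤k jk k<ek = proj₁ jk , subst (suc k ℕ.≤_) (join-end k jk 1≤k) k<ek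

  join-cross : ∀ x y → InJoin x → 1 ℕ.≤ x → end x ℕ.< y → ¬ InJoin y
  join-cross x y jx x1 h (_ , yh) = ℕP.<-irrefl refl (ℕP.<-≤-trans h (subst (y ℕ.≤_) (sym (join-end x jx x1)) yh))

  join-<-start : ∀ x y → InJoin x → ¬ InJoin y → y ℕ.≤ n → x ℕ.< start y
  join-<-start x y (s , xh) nj yn = ℕP.≤-<-trans xh (end-<-start 1 y yn (end1-<-nonjoin y nj s))

  BlockIncreasing : (ℕ → ℤ) → Set
  BlockIncreasing F = (split ≡ false → 1 ℕ.≤ n → + 0 ℤ.< F 1) ×
                      (∀ k → 1 ℕ.≤ k → k ℕ.< n → ¬ (k ∈ P) → F k ℤ.< F (suc k))

  increasing-inBlock : ∀ F → BlockIncreasing F → ∀ x y → 1 ℕ.≤ x → x ℕ.< y → y ℕ.≤ end x → F x ℤ.< F y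
  increasing-inBlock F inc x (suc y) x1 (s≤s xy) yh with ℕP.m≤n⇒m<n∨m≡n xy
  ... | inj₂ refl = proj₂ inc x x1 (ℕP.<-≤-trans yh (end-≤ x)) (∈-end⇒∉ x x ℕP.≤-refl yh)
  ... | inj₁ lt = ℤP.<-trans (increasing-inBlock F inc x y x1 lt (ℕP.<⇒≤ yh))
      (proj₂ inc y (ℕP.≤-trans x1 xy) (ℕP.<-≤-trans yh (end-≤ x)) (∈-end⇒∉ x y xy yh))

  join-positive : ∀ F → BlockIncreasing F → ∀ x → InJoin x → 1 ℕ.≤ x → + 0 ℤ.< F x
  join-positive F inc x j@(s , xh) x1 with ℕP.m≤n⇒m<n∨m≡n x1
  ... | inj₂ e = subst (λ z → + 0 ℤ.< F z) e (proj₁ inc s (ℕP.≤-trans x1 (ℕP.≤-trans xh (end-≤ 1))))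
  ... | inj₁ lt = ℤP.<-trans (proj₁ inc s (ℕP.≤-trans x1 (ℕP.≤-trans xh (end-≤ 1))))
                             (increasing-inBlock F inc 1 x ℕP.≤-refl lt xh)

  IsSignedPerm₁ : (ℕ → ℤ) → Set
  IsSignedPerm₁ F = IsSignedPermFn n (F ∘ suc)

  ∣∣-bounded : ∀ F → IsSignedPerm₁ F → ∀ x → InRange x → (1 ℕ.≤ ∣ F x ∣) × (∣ F x ∣ ℕ.≤ n)
  ∣∣-bounded F sp (suc k) (_ , xn) = proj₁ sp k xn

  ∣∣-injective : ∀ F → IsSignedPerm₁ F → ∀ x y → InRange x → InRange y → ∣ F x ∣ ≡ ∣ F y ∣ → x ≡ y
  ∣∣-injective F sp (suc k) (suc l) (_ , xn) (_ , yn) e = cong suc (proj₂ sp k l xn yn e)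

  ≢0₁ : ∀ F → IsSignedPerm₁ F → ∀ x → InRange x → F x ≢ + 0
  ≢0₁ F sp (suc k) (_ , k<) = ≢0 (F ∘ suc) sp k k<

  ≢₁ : ∀ F → IsSignedPerm₁ F → ∀ x y → InRange x → InRange y → x ≢ y → F x ≢ F y
  ≢₁ F sp x y rx ry ne e = ne (∣∣-injective F sp x y rx ry (cong ∣_∣ e))

  ≢-₁ : ∀ F → IsSignedPerm₁ F → ∀ x y → InRange x → InRange y → x ≢ y → F x ≢ ℤ.- F y
  ≢-₁ F sp x y rx ry ne e = ne (∣∣-injective F sp x y rx ry (trans (cong ∣_∣ e) (ℤP.∣-i∣≡∣i∣ (F y))))

  _⊆ᴵ_ : (ℕ → ℤ) → (ℕ → ℤ) → Set
  F ⊆ᴵ G = InvSubset n (F ∘ suc) (G ∘ suc)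

  module _ {F G : ℕ → ℤ} (F⊆G : F ⊆ᴵ G) where

    ⊆ᴵ-sign : ∀ x → InRange x → F x ℤ.< + 0 → G x ℤ.< + 0
    ⊆ᴵ-sign (suc k) (_ , k<) = proj₁ F⊆G k k<

    ⊆ᴵ-pos : ∀ x y → InRange x → InRange y → x ℕ.< y → F y ℤ.< F x → G y ℤ.< G x
    ⊆ᴵ-pos (suc i) (suc j) _ (_ , j<) (s≤s i<j) = proj₁ (proj₂ F⊆G) i j i<j j<

    ⊆ᴵ-neg : ∀ x y → InRange x → InRange y → x ℕ.< y → F x ℤ.< ℤ.- F y → G x ℤ.< ℤ.- G y
    ⊆ᴵ-neg (suc i) (suc j) _ (_ , j<) (s≤s i<j) = proj₂ (proj₂ F⊆G) i j i<j j<

  ⊆ᴵ-intro : ∀ {F G} →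
    (∀ x → InRange x → F x ℤ.< + 0 → G x ℤ.< + 0) →
    (∀ x y → InRange x → InRange y → x ℕ.< y → F y ℤ.< F x → G y ℤ.< G x) →
    (∀ x y → InRange x → InRange y → x ℕ.< y → F x ℤ.< ℤ.- F y → G x ℤ.< ℤ.- G y) →
    F ⊆ᴵ G
  ⊆ᴵ-intro sign pos neg =
    (λ k k< → sign (suc k) (s≤s z≤n , k<)) ,
    (λ i j i<j j< → pos (suc i) (suc j) (s≤s z≤n , ℕP.<-trans i<j j<) (s≤s z≤n , j<) (s≤s i<j)) ,
    (λ i j i<j j< → neg (suc i) (suc j) (s≤s z≤n , ℕP.<-trans i<j j<) (s≤s z≤n , j<) (s≤s i<j))

  BlockIncreasing-sign : ∀ F → BlockIncreasing F → ∀ x → InRange x → F x ℤ.< + 0 → ¬ InJoin x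
  BlockIncreasing-sign F inc x r lt j = ℤP.<-asym lt (join-positive F inc x j (proj₁ r))

  BlockIncreasing-pos : ∀ F → BlockIncreasing F → ∀ x y → InRange x → x ℕ.< y → F y ℤ.< F x → end x ℕ.< y
  BlockIncreasing-pos F inc x y r x<y lt = ℕP.≰⇒> (λ yh → ℤP.<-asym lt (increasing-inBlock F inc x y (proj₁ r) x<y yh))

  BlockIncreasing-neg : ∀ F → BlockIncreasing F → ∀ x y → InRange x → x ℕ.< y → F x ℤ.< ℤ.- F y → ¬ InJoin y
  BlockIncreasing-neg F inc x y r x<y lt jy =
    ℤP.<-asym (ℤP.<-trans lt (ℤP.neg-mono-< (join-positive F inc y jy (ℕP.≤-trans (proj₁ r) (ℕP.<⇒≤ x<y)))))
              (join-positive F inc x (join-downward x y jy (ℕP.<⇒≤ x<y)) (proj₁ r))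

  ∣longest∣ : ℕ → ℕ
  ∣longest∣ x = ∣ longest x ∣

  ∣longest∣-join : ∀ x → InJoin x → ∣longest∣ x ≡ x
  ∣longest∣-join x j = cong ∣_∣ (longest-join x j)

  ∣longest∣-nonjoin : ∀ x → ¬ InJoin x → ∣longest∣ x ≡ reflect x
  ∣longest∣-nonjoin x nj = trans (cong ∣_∣ (longest-nonjoin x nj)) (ℤP.∣-i∣≡∣i∣ (+ reflect x))

  nonjoin-reflect : ∀ x → InRange x → ¬ InJoin x → ¬ InJoin (reflect x)
  nonjoin-reflect x r nj = nonjoin-upward x (reflect x) nj (proj₂ r) (proj₁ (reflect-inBlock x r))

  ∣longest∣-InRange : ∀ x → InRange x → InRange (∣longest∣ x)
  ∣longest∣-InRange x r = byJoin x
    (λ j → subst InRange (sym (∣longest∣-join x j)) r)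
    (λ nj → subst InRange (sym (∣longest∣-nonjoin x nj)) (reflect-InRange x r))

  ∣longest∣-involutive : ∀ x → InRange x → ∣longest∣ (∣longest∣ x) ≡ x
  ∣longest∣-involutive x r = byJoin x
    (λ j → trans (cong ∣longest∣ (∣longest∣-join x j)) (∣longest∣-join x j))
    (λ nj → trans (cong ∣longest∣ (∣longest∣-nonjoin x nj))
                  (trans (∣longest∣-nonjoin (reflect x) (nonjoin-reflect x r nj)) (reflect-involutive x r)))

  ∣longest∣-injective : ∀ x y → InRange x → InRange y → ∣longest∣ x ≡ ∣longest∣ y → x ≡ y
  ∣longest∣-injective x y rx ry e =
    trans (sym (∣longest∣-involutive x rx)) (trans (cong ∣longest∣ e) (∣longest∣-involutive y ry))

  longest-isSignedPerm : IsSignedPerm₁ longest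
  longest-isSignedPerm = (λ k k< → ∣longest∣-InRange (suc k) (s≤s z≤n , k<)) ,
         (λ k l k< l< e → ℕP.suc-injective (∣longest∣-injective (suc k) (suc l) (s≤s z≤n , k<) (s≤s z≤n , l<) e))

  longest-blockIncreasing : BlockIncreasing longest
  longest-blockIncreasing = (λ s 1≤n → subst (+ 0 ℤ.<_) (sym (longest-join 1 (s , ≤-end 1 1≤n))) (ℤ.+<+ (s≤s z≤n))) , step
    where
    step : ∀ k → 1 ℕ.≤ k → k ℕ.< n → ¬ (k ∈ P) → longest k ℤ.< longest (suc k)
    step k 1≤k k<n k∉ = byJoin k
      (λ jk → subst₂ ℤ._<_ (sym (longest-join k jk)) (sym (longest-join (suc k) (join-suc k 1≤k jk k<ek)))
                (ℤ.+<+ (ℕP.n<1+n k)))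
      λ njk → let nsk = nonjoin-upward k (suc k) njk (ℕP.<⇒≤ k<n) (ℕP.≤-trans (start-≤ k 1≤k) (ℕP.n≤1+n k)) in
        subst₂ ℤ._<_ (sym (longest-nonjoin k njk)) (sym (longest-nonjoin (suc k) nsk))
          (ℤP.neg-mono-< (ℤ.+<+ (reflect-antitone k (suc k) (1≤k , ℕP.<⇒≤ k<n) (ℕP.n<1+n k) k<ek)))
      where
      k<ek = ∉⇒<-end k k<n k∉

  longest-sign : ∀ x → InRange x → ¬ InJoin x → longest x ℤ.< + 0
  longest-sign x r nj = subst (ℤ._< + 0) (sym (longest-nonjoin x nj)) (-n<0 (reflect x) (proj₁ (reflect-InRange x r)))

  longest-pos : ∀ x y → InRange x → InRange y → x ℕ.< y → end x ℕ.< y → longest y ℤ.< longest x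
  longest-pos x y rx ry x<y h = byJoin x
    (λ jx → subst₂ ℤ._<_ (sym (longest-nonjoin y (join-cross x y jx (proj₁ rx) h))) (sym (longest-join x jx))
      (ℤP.<-trans (-n<0 (reflect y) (proj₁ (reflect-InRange y ry))) (ℤ.+<+ (proj₁ rx))))
    λ nx → let ny = nonjoin-upward x y nx (proj₂ rx) (ℕP.≤-trans (start-≤ x (proj₁ rx)) (ℕP.<⇒≤ x<y)) in
      subst₂ ℤ._<_ (sym (longest-nonjoin y ny)) (sym (longest-nonjoin x nx))
        (ℤP.neg-mono-< (ℤ.+<+ (reflect-monotone-across x y rx ry h)))

  longest-neg : ∀ x y → InRange x → InRange y → x ℕ.< y → ¬ InJoin y → longest x ℤ.< ℤ.- longest y
  longest-neg x y rx ry x<y ny =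
    subst (longest x ℤ.<_) (sym (trans (cong ℤ.-_ (longest-nonjoin y ny)) (ℤP.neg-involutive _))) lem
    where
    lem : longest x ℤ.< + reflect y
    lem = byJoin x
      (λ jx → subst (ℤ._< + reflect y) (sym (longest-join x jx))
        (ℤ.+<+ (ℕP.<-≤-trans (join-<-start x y jx ny (proj₂ ry)) (proj₁ (reflect-inBlock y ry)))))
      (λ nx → subst (ℤ._< + reflect y) (sym (longest-nonjoin x nx))
        (ℤP.<-trans (-n<0 (reflect x) (proj₁ (reflect-InRange x rx))) (ℤ.+<+ (proj₁ (reflect-InRange y ry)))))

  -- |F ∘ ∣longest∣| is strictly increasing on 1, …, n, hence the identity, and the signs of F are forced
  module _ (F : ℕ → ℤ) (inc : BlockIncreasing F) (sp : IsSignedPerm₁ F) (longest⊆F : longest ⊆ᴵ F) where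

    nonjoin-negative : ∀ x → InRange x → ¬ InJoin x → F x ℤ.< + 0
    nonjoin-negative x r nj = ⊆ᴵ-sign {longest} {F} longest⊆F x r (longest-sign x r nj)

    cross-descent : ∀ x y → InRange x → InRange y → x ℕ.< y → end x ℕ.< y → F y ℤ.< F x
    cross-descent x y rx ry x<y ex<y = ⊆ᴵ-pos {longest} {F} longest⊆F x y rx ry x<y (longest-pos x y rx ry x<y ex<y)

    nonjoin-negPair : ∀ x y → InRange x → InRange y → x ℕ.< y → ¬ InJoin y → F x ℤ.< ℤ.- F y
    nonjoin-negPair x y rx ry x<y ny = ⊆ᴵ-neg {longest} {F} longest⊆F x y rx ry x<y (longest-neg x y rx ry x<y ny)

    ∣longest∣-increasing-interior : ∀ m → InRange m → m ℕ.< n → ¬ (m ∈ P) →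
      ∣ F (∣longest∣ m) ∣ ℕ.< ∣ F (∣longest∣ (suc m)) ∣
    ∣longest∣-increasing-interior m r@(1≤m , _) m<n m∉ = byJoin m
      (λ jm → let jsm = join-suc m 1≤m jm m<em in
        subst₂ (λ a b → ∣ F a ∣ ℕ.< ∣ F b ∣) (sym (∣longest∣-join m jm)) (sym (∣longest∣-join (suc m) jsm))
          (0<i<j⇒∣i∣<∣j∣ (join-positive F inc m jm 1≤m) (increasing-inBlock F inc m (suc m) 1≤m (ℕP.n<1+n m) m<em)))
      λ njm → let nsm = nonjoin-upward m (suc m) njm (proj₂ r) (ℕP.≤-trans (start-≤ m 1≤m) (ℕP.n≤1+n m)) in
        subst₂ (λ a b → ∣ F a ∣ ℕ.< ∣ F b ∣)
          (sym (trans (∣longest∣-nonjoin m njm) (sym sa≡rm))) (sym (∣longest∣-nonjoin (suc m) nsm))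
          (i<j<0⇒∣j∣<∣i∣ (increasing-inBlock F inc a (suc a) (proj₁ ra) (ℕP.n<1+n a) sa≤ea)
            (subst (λ z → F z ℤ.< + 0) (sym sa≡rm)
              (nonjoin-negative (reflect m) (reflect-InRange m r) (nonjoin-reflect m r njm))))
      where
      m<em = ∉⇒<-end m m<n m∉
      rsm : InRange (suc m)
      rsm = s≤s z≤n , m<n
      a = reflect (suc m)
      ra = reflect-InRange (suc m) rsm
      sa≡rm : suc a ≡ reflect m
      sa≡rm = reflect-suc m r m<em
      ea≡em : end a ≡ end m
      ea≡em = trans (proj₁ (reflect-sameBlock (suc m) rsm))
                    (proj₁ (sameBlock m (suc m) r (ℕP.≤-trans (start-≤ m 1≤m) (ℕP.n≤1+n m)) m<em))
      sa≤ea : suc a ℕ.≤ end a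
      sa≤ea = subst₂ ℕ._≤_ (sym sa≡rm) (sym ea≡em) (proj₂ (reflect-inBlock m r))

    ∣longest∣-increasing-boundary : ∀ m → InRange m → m ℕ.< n → m ∈ P →
      ∣ F (∣longest∣ m) ∣ ℕ.< ∣ F (∣longest∣ (suc m)) ∣
    ∣longest∣-increasing-boundary m r@(1≤m , m≤n) m<n m∈ =
      j<i<-j⇒∣i∣<∣j∣ (cross-descent x y rx ry x<y ex<y) (nonjoin-negPair x y rx ry x<y ny)
      where
      rsm : InRange (suc m)
      rsm = s≤s z≤n , m<n
      em<sm : end m ℕ.< suc m
      em<sm = subst (ℕ._< suc m) (sym (end-∈ m m∈ m≤n)) (ℕP.n<1+n m)
      nsm : ¬ InJoin (suc m)
      nsm j = join-cross m (suc m) (join-downward m (suc m) j (ℕP.n≤1+n m)) 1≤m em<sm j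
      x = ∣longest∣ m
      y = ∣longest∣ (suc m)
      rx = ∣longest∣-InRange m r
      ry = ∣longest∣-InRange (suc m) rsm
      y≡rsm : y ≡ reflect (suc m)
      y≡rsm = ∣longest∣-nonjoin (suc m) nsm
      ex≡em : end x ≡ end m
      ex≡em = byJoin m (λ jm → cong end (∣longest∣-join m jm))
                       (λ njm → trans (cong end (∣longest∣-nonjoin m njm)) (proj₁ (reflect-sameBlock m r)))
      ex<y : end x ℕ.< y
      ex<y = subst₂ ℕ._<_ (sym ex≡em) (sym y≡rsm)
               (ℕP.<-≤-trans (end-<-start m (suc m) m<n em<sm) (proj₁ (reflect-inBlock (suc m) rsm)))
      x<y : x ℕ.< y
      x<y = ℕP.≤-<-trans (≤-end x (proj₂ rx)) ex<y
      ny : ¬ InJoin y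
      ny = subst (λ z → ¬ InJoin z) (sym y≡rsm) (nonjoin-reflect (suc m) rsm nsm)

    ∣longest∣-increasing : ∀ m → InRange m → m ℕ.< n → ∣ F (∣longest∣ m) ∣ ℕ.< ∣ F (∣longest∣ (suc m)) ∣
    ∣longest∣-increasing m r m<n with m ∈? P
    ... | no m∉ = ∣longest∣-increasing-interior m r m<n m∉
    ... | yes m∈ = ∣longest∣-increasing-boundary m r m<n m∈

    ∣F∘∣longest∣∣≡id : ∀ m → InRange m → ∣ F (∣longest∣ m) ∣ ≡ m
    ∣F∘∣longest∣∣≡id (suc k) (_ , k<) = increasing-bounded⇒≡suc n (λ k → ∣ F (∣longest∣ (suc k)) ∣)
      (λ k sk< → ∣longest∣-increasing (suc k) (s≤s z≤n , ℕP.<⇒≤ sk<) sk<)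
      (λ k k< → ∣∣-bounded F sp (∣longest∣ (suc k)) (∣longest∣-InRange (suc k) (s≤s z≤n , k<))) k k<

    ∣F∣≡∣longest∣ : ∀ x → InRange x → ∣ F x ∣ ≡ ∣longest∣ x
    ∣F∣≡∣longest∣ x r = trans (cong (λ z → ∣ F z ∣) (sym (∣longest∣-involutive x r)))
                             (∣F∘∣longest∣∣≡id (∣longest∣ x) (∣longest∣-InRange x r))

    ≡longest : ∀ x → InRange x → F x ≡ longest x
    ≡longest x r = byJoin x
      (λ j → trans (sym (ℤP.0≤i⇒+∣i∣≡i (ℤP.<⇒≤ (join-positive F inc x j (proj₁ r)))))
               (trans (cong +_ (trans (∣F∣≡∣longest∣ x r) (∣longest∣-join x j))) (sym (longest-join x j))))
      λ nj → trans (i<0⇒i≡-∣i∣ (nonjoin-negative x r nj))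
               (trans (cong (λ z → ℤ.- (+ z)) (trans (∣F∣≡∣longest∣ x r) (∣longest∣-nonjoin x nj)))
                      (sym (longest-nonjoin x nj)))

  -- On cross pairs the inversions of composeLongest G are the non-inversions of G, and Inv(U) ⊆ Inv(V)
  -- turns every non-inversion of V into one of U (strict, since U is a signed permutation).
  module _ (U V : ℕ → ℤ) (V-inc : BlockIncreasing V) (U-perm : IsSignedPerm₁ U) (U⊆V : U ⊆ᴵ V) where

    private
      sign-reflect : ∀ x → InRange x → + 0 ℤ.< V x → + 0 ℤ.< U x
      sign-reflect x r 0<Vx =
        ≮∧≢⇒> (λ Ux<0 → ℤP.<-asym 0<Vx (⊆ᴵ-sign {U} {V} U⊆V x r Ux<0)) (≢0₁ U U-perm x r)

      pos-reflect : ∀ x y → InRange x → InRange y → x ℕ.< y → V x ℤ.< V y → U x ℤ.< U y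
      pos-reflect x y rx ry x<y Vx<Vy =
        ≮∧≢⇒> (λ Uy<Ux → ℤP.<-asym Vx<Vy (⊆ᴵ-pos {U} {V} U⊆V x y rx ry x<y Uy<Ux))
              (≢₁ U U-perm y x ry rx (λ y≡x → ℕP.<-irrefl (sym y≡x) x<y))

      neg-reflect : ∀ x y → InRange x → InRange y → x ℕ.< y → ℤ.- V y ℤ.< V x → ℤ.- U y ℤ.< U x
      neg-reflect x y rx ry x<y -Vy<Vx =
        ≮∧≢⇒> (λ Ux<-Uy → ℤP.<-asym -Vy<Vx (⊆ᴵ-neg {U} {V} U⊆V x y rx ry x<y Ux<-Uy))
              (≢-₁ U U-perm x y rx ry (λ x≡y → ℕP.<-irrefl x≡y x<y))

    composeLongest-sign : ∀ x → InRange x → composeLongest V x ℤ.< + 0 → composeLongest U x ℤ.< + 0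
    composeLongest-sign x r h = byJoin x
      (λ j → ⊥-elim (ℤP.<-asym (subst (ℤ._< + 0) (composeLongest-join V x j) h) (join-positive V V-inc x j (proj₁ r))))
      (λ nj → subst (ℤ._< + 0) (sym (composeLongest-nonjoin U x nj))
        (ℤP.neg-mono-< (sign-reflect (reflect x) (reflect-InRange x r)
          (ℤP.neg-cancel-< (subst (ℤ._< + 0) (composeLongest-nonjoin V x nj) h)))))

    composeLongest-pos : ∀ x y → InRange x → InRange y → x ℕ.< y →
      composeLongest V y ℤ.< composeLongest V x → composeLongest U y ℤ.< composeLongest U x
    composeLongest-pos x y rx ry x<y h with end x ℕ.<? y
    ... | no ex≮y = ⊥-elim (byJoin y
          (λ jy → let jx = join-downward x y jy (ℕP.<⇒≤ x<y) in
            ℤP.<-asym (subst₂ ℤ._<_ (composeLongest-join V y jy) (composeLongest-join V x jx) h)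
                      (increasing-inBlock V V-inc x y (proj₁ rx) x<y y≤ex))
          λ ny → byJoin x
            (λ jx → ny (proj₁ jx , subst (y ℕ.≤_) (join-end x jx (proj₁ rx)) y≤ex))
            λ nx → ℤP.<-asym (ℤP.neg-cancel-< (subst₂ ℤ._<_ (composeLongest-nonjoin V y ny) (composeLongest-nonjoin V x nx) h))
                     (increasing-inBlock V V-inc (reflect y) (reflect x) (proj₁ (reflect-InRange y ry))
                       (reflect-antitone x y rx x<y y≤ex) rx≤ery))
      where
      y≤ex = ℕP.≮⇒≥ ex≮y
      rx≤ery : reflect x ℕ.≤ end (reflect y)
      rx≤ery = subst (reflect x ℕ.≤_)
        (sym (trans (proj₁ (reflect-sameBlock y ry))
                    (proj₁ (sameBlock x y rx (ℕP.≤-trans (start-≤ x (proj₁ rx)) (ℕP.<⇒≤ x<y)) y≤ex))))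
        (proj₂ (reflect-inBlock x rx))
    ... | yes ex<y = byJoin x
          (λ jx → let ny = join-cross x y jx (proj₁ rx) ex<y in
            subst₂ ℤ._<_ (sym (composeLongest-nonjoin U y ny)) (sym (composeLongest-join U x jx))
              (neg-reflect x (reflect y) rx (reflect-InRange y ry)
                (ℕP.<-≤-trans (join-<-start x y jx ny (proj₂ ry)) (proj₁ (reflect-inBlock y ry)))
                (subst₂ ℤ._<_ (composeLongest-nonjoin V y ny) (composeLongest-join V x jx) h)))
          λ nx → let ny = nonjoin-upward x y nx (proj₂ rx) (ℕP.≤-trans (start-≤ x (proj₁ rx)) (ℕP.<⇒≤ x<y)) in
            subst₂ ℤ._<_ (sym (composeLongest-nonjoin U y ny)) (sym (composeLongest-nonjoin U x nx))
              (ℤP.neg-mono-< (pos-reflect (reflect x) (reflect y) (reflect-InRange x rx) (reflect-InRange y ry)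
                (reflect-monotone-across x y rx ry ex<y)
                (ℤP.neg-cancel-< (subst₂ ℤ._<_ (composeLongest-nonjoin V y ny) (composeLongest-nonjoin V x nx) h))))

    composeLongest-neg : ∀ x y → InRange x → InRange y → x ℕ.< y →
      composeLongest V x ℤ.< ℤ.- composeLongest V y → composeLongest U x ℤ.< ℤ.- composeLongest U y
    composeLongest-neg x y rx ry x<y h = byJoin y
      (λ jy → let jx = join-downward x y jy (ℕP.<⇒≤ x<y) in
        ⊥-elim (ℤP.<-asym (ℤP.<-trans (subst₂ (λ a b → a ℤ.< ℤ.- b) (composeLongest-join V x jx) (composeLongest-join V y jy) h)
                                       (ℤP.neg-mono-< (join-positive V V-inc y jy (proj₁ ry))))
                          (join-positive V V-inc x jx (proj₁ rx))))
      λ ny → subst (composeLongest U x ℤ.<_) (sym (-composeLongest U y ny)) (byJoin x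
        (λ jx → subst (ℤ._< U (reflect y)) (sym (composeLongest-join U x jx))
          (pos-reflect x (reflect y) rx (reflect-InRange y ry)
            (ℕP.<-≤-trans (join-<-start x y jx ny (proj₂ ry)) (proj₁ (reflect-inBlock y ry)))
            (subst₂ ℤ._<_ (composeLongest-join V x jx) (-composeLongest V y ny) h)))
        λ nx → subst (ℤ._< U (reflect y)) (sym (composeLongest-nonjoin U x nx))
          (both-nonjoin (reflect-InRange x rx) (reflect-InRange y ry)
            (λ e → ℕP.<-irrefl (reflect-injective x y rx ry e) x<y)
            (subst₂ ℤ._<_ (composeLongest-nonjoin V x nx) (-composeLongest V y ny) h)))
      where
      -composeLongest : ∀ G y → ¬ InJoin y → ℤ.- composeLongest G y ≡ G (reflect y)
      -composeLongest G y ny = trans (cong ℤ.-_ (composeLongest-nonjoin G y ny)) (ℤP.neg-involutive _)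
      both-nonjoin : ∀ {a b} → InRange a → InRange b → a ≢ b → ℤ.- V a ℤ.< V b → ℤ.- U a ℤ.< U b
      both-nonjoin {a} {b} ra rb a≢b -Va<Vb with ℕP.<-cmp a b
      ... | tri< a<b _ _ = -i<j⇒-j<i (neg-reflect a b ra rb a<b (-i<j⇒-j<i -Va<Vb))
      ... | tri≈ _ a≡b _ = ⊥-elim (a≢b a≡b)
      ... | tri> _ _ b<a = neg-reflect b a rb ra b<a -Va<Vb

    composeLongest-antitone : composeLongest V ⊆ᴵ composeLongest U
    composeLongest-antitone = ⊆ᴵ-intro composeLongest-sign composeLongest-pos composeLongest-neg

-- Identifying the longest element of 𝔖^B_α

apply₊ : ∀ {n} → SPerm n → ℕ → ℤ
apply₊ π x = apply π (+ x)

innerSums-> : ∀ acc αs → All (1 ℕ.≤_) αs → ∀ p → p ∈ innerSums acc αs → acc ℕ.< p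
innerSums-> acc (a ∷ b ∷ αs) (1≤a ∷ _) p (here refl) = ℕP.m<m+n acc 1≤a
innerSums-> acc (a ∷ b ∷ αs) (1≤a ∷ all) p (there p∈) =
  ℕP.<-trans (ℕP.m<m+n acc 1≤a) (innerSums-> (acc + a) (b ∷ αs) all p p∈)

¬descent⇒≮ : ∀ {n} f k (k< : suc k ℕ.< n) → ¬ IsDescent f (fromℕ< k<) → ¬ (f (suc k) ℤ.< f k)
¬descent⇒≮ {suc (suc n)} f k (s≤s k<) ¬d =
  subst (λ i → ¬ (f (suc i) ℤ.< f i)) (FP.toℕ-fromℕ< k<) ¬d

module _ {n : ℕ} (split : Bool) (αs : List ℕ) (αs-positive : All (1 ℕ.≤_) αs) where

  open Longest n split (innerSums 0 αs)

  0∉J : split ≡ false → ¬ InJ split αs 0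
  0∉J refl (inj₁ (_ , ()))
  0∉J _ (inj₂ 0∈) = ℕP.<-irrefl refl (innerSums-> 0 αs αs-positive 0 0∈)

  -- s₀ ∉ J_α exactly when α is a join composition, and s_k ∉ J_α exactly when k is interior to a block
  noDescentOutsideJ⇒BlockIncreasing : (π : SPerm n) → IsSignedPermFn n (at π) →
    (∀ (s : Fin n) → ¬ InJ split αs (toℕ s) → ¬ IsDescent (at π) s) → BlockIncreasing (apply₊ π)
  noDescentOutsideJ⇒BlockIncreasing π sp noDescent = positive , increasing
    where
    positive : split ≡ false → 1 ℕ.≤ n → + 0 ℤ.< at π 0
    positive sf (s≤s z≤n) = ≮∧≢⇒> (noDescent F.zero (0∉J sf)) (≢0 (at π) sp 0 (s≤s z≤n))
    increasing : ∀ k → 1 ℕ.≤ k → k ℕ.< n → ¬ (k ∈ innerSums 0 αs) → apply₊ π k ℤ.< apply₊ π (suc k)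
    increasing (suc k) _ k< k∉ = ≮∧≢⇒> (¬descent⇒≮ (at π) k k< (noDescent (fromℕ< k<) k∉J)) (≢neighbour (at π) sp k k<)
      where
      k∉J : ¬ InJ split αs (toℕ (fromℕ< k<))
      k∉J (inj₁ (toℕ≡0 , _)) = ℕP.1+n≢0 (trans (sym (FP.toℕ-fromℕ< k<)) toℕ≡0)
      k∉J (inj₂ k∈) = k∉ (subst (_∈ _) (FP.toℕ-fromℕ< k<) k∈)

  BlockIncreasing⇒noDescentOutsideJ : (π : SPerm n) (F : ℕ → ℤ) → (∀ k → k ℕ.< n → at π k ≡ F (suc k)) →
    BlockIncreasing F → ∀ (s : Fin n) → ¬ InJ split αs (toℕ s) → ¬ IsDescent (at π) s
  BlockIncreasing⇒noDescentOutsideJ π F at≡ (positive , _) F.zero s∉J d =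
    ℤP.<-asym (subst (ℤ._< + 0) (at≡ 0 (s≤s z≤n)) d)
              (positive (BoolP.¬-not (λ split≡true → s∉J (inj₁ (refl , split≡true)))) (s≤s z≤n))
  BlockIncreasing⇒noDescentOutsideJ π F at≡ (_ , increasing) (F.suc s) s∉J d =
    ℤP.<-asym (subst₂ ℤ._<_ (at≡ (suc i) (FP.toℕ<n (F.suc s))) (at≡ i (ℕP.<-trans ℕP.≤-refl (FP.toℕ<n (F.suc s)))) d)
      (increasing (suc i) (s≤s z≤n) (FP.toℕ<n (F.suc s)) (s∉J ∘ inj₂))
    where i = toℕ s

  InH⇒BlockIncreasing : (π : SPerm n) → InH split αs π → BlockIncreasing (apply₊ π)
  InH⇒BlockIncreasing π (isPerm , ascents) = noDescentOutsideJ⇒BlockIncreasing π sp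
    (λ s s∉J → LengthLess⇒ascent π s sp (ascents s s∉J))
    where sp = IsSignedPerm⇒Fn π isPerm

  ω₀ : SPerm n
  ω₀ = V.tabulate (longest ∘ suc ∘ toℕ)

  at-ω₀ : ∀ k → k ℕ.< n → at ω₀ k ≡ longest (suc k)
  at-ω₀ = at-tabulate _ (longest ∘ suc) (λ j → refl)

  ω₀-isSignedPerm : IsSignedPermFn n (at ω₀)
  ω₀-isSignedPerm = IsSignedPermFn-cong n _ _ (λ k k< → sym (at-ω₀ k k<)) longest-isSignedPerm

  ω₀-InH : InH split αs ω₀
  ω₀-InH = Fn⇒IsSignedPerm ω₀ ω₀-isSignedPerm , λ s s∉J →
    ascent⇒LengthLess ω₀ s ω₀-isSignedPerm (BlockIncreasing⇒noDescentOutsideJ ω₀ longest at-ω₀ longest-blockIncreasing s s∉J)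

  module _ (ω : SPerm n) (ω-longest : IsLongestInH split αs ω) where

    private
      ω-perm = IsSignedPerm⇒Fn ω (proj₁ (proj₁ ω-longest))
      ω-inc = InH⇒BlockIncreasing ω (proj₁ ω-longest)

    -- ω lies in 𝔖^B_α, so all its inversions are among those of ω₀; being longest, it has all of them
    ω⊆longest : apply₊ ω ⊆ᴵ longest
    ω⊆longest = ⊆ᴵ-intro
      (λ x r neg → longest-sign x r (BlockIncreasing-sign _ ω-inc x r neg))
      (λ x y rx ry x<y inv → longest-pos x y rx ry x<y (BlockIncreasing-pos _ ω-inc x y rx x<y inv))
      (λ x y rx ry x<y inv → longest-neg x y rx ry x<y (BlockIncreasing-neg _ ω-inc x y rx x<y inv))

    longest⊆ω : longest ⊆ᴵ apply₊ ω
    longest⊆ω = InvSubset-reflect n (at ω) (longest ∘ suc) ω⊆longest (begin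
      inversions n (longest ∘ suc)  ≡⟨ inversions-cong n _ _ at-ω₀ ⟨
      inversionNumber ω₀            ≤⟨ proj₂ ω-longest ω₀ ω₀-InH _ _ (hasLength-inversionNumber ω₀ ω₀-isSignedPerm)
                                         (hasLength-inversionNumber ω ω-perm) ⟩
      inversionNumber ω             ∎)
      where open ℕP.≤-Reasoning

    apply₊-longestInH : ∀ x → InRange x → apply₊ ω x ≡ longest x
    apply₊-longestInH = ≡longest (apply₊ ω) ω-inc ω-perm longest⊆ω

    at-·longestInH : ∀ (π : SPerm n) k → k ℕ.< n → at (π · ω) k ≡ composeLongest (apply₊ π) (suc k)
    at-·longestInH π k k< = trans (apply-· π ω (+ suc k)) (trans (cong (apply π) (apply₊-longestInH x r)) (byJoin x
      (λ j → trans (cong (apply π) (longest-join x j)) (sym (composeLongest-join (apply₊ π) x j)))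
      (λ nj → trans (cong (apply π) (longest-nonjoin x nj))
                (trans (apply-neg π (+ reflect x)) (sym (composeLongest-nonjoin (apply₊ π) x nj))))))
      where
      x = suc k
      r = (s≤s z≤n , k<)

proposition62 : (n : ℕ) (split : Bool) (αs : List ℕ) →
    IsTypeBComposition n split αs →
    (ω : SPerm n) → IsLongestInH split αs ω →
    (u v : SPerm n) → InH split αs u → InH split αs v →
    u ≤weak v → (v · ω) ≤weak (u · ω)
proposition62 n split αs (αs-positive , _) ω ω-longest u v u∈H v∈H u≤v =
  InvSubset⇒≤weak (InvSubset-trans (InvSubset-cong n _ _ (at-·ω v))
    (InvSubset-trans (composeLongest-antitone (apply₊ u) (apply₊ v) (InH⇒BlockIncreasing split αs αs-positive v v∈H)
                       (IsSignedPerm⇒Fn u (proj₁ u∈H)) (≤weak⇒InvSubset u≤v))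
      (InvSubset-cong n _ _ (λ k k< → sym (at-·ω u k k<)))))
  where
  -- blocks are cut off at n
  open Longest n split (innerSums 0 αs)
  at-·ω = at-·longestInH split αs αs-positive ω ω-longest
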